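{- Let $\alpha,\beta$ be integers, excluding the case $-\alpha=\beta>0$. There exists a 2-ary $(\alpha,\beta)$-Conolly meta-Fibonacci recursion if and only if $\beta\ge 0$, $\alpha+\beta>0$, and $\alpha$ is even.
   Context: The ruler function $r_m$ ($m\ge1$) is $1$ plus the exponent of $2$ in the prime factorization of $m$. A nondecreasing sequence of positive integers is $(\alpha,\beta)$-Conolly if for every positive integer $m$ the number of times $m$ occurs in it is $\alpha+\beta r_m$. A 2-ary meta-Fibonacci recursion (of order $p$) is a recursion $R(n)=R\big(n-s-\sum_{j=1}^p R(n-a_j)\big)+R\big(n-t-\sum_{j=1}^p R(n-b_j)\big)$ with integers $p\ge1$, $s,t\ge 0$, $a_j,b_j\ge 1$; it is $(\alpha,\beta)$-Conolly if for some choice of finitely many positive initial values $R(1),\dots,R(c)$ the recursion has a well-defined solution for all $n$ (all arguments positive) which is $(\alpha,\beta)$-Conolly. -}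

module Defs where

open import Data.Nat as ℕ using (ℕ; zero; suc; _+_; _∸_; _≤_; _<_; _/_; _%_)
open import Data.Integer as ℤ using (ℤ; +_)
open import Data.Vec using (Vec; map; sum; toList)
open import Data.List using (List; length)
open import Data.List.Membership.Propositional using (_∈_)
open import Data.List.Relation.Unary.All using (All)
open import Data.List.Relation.Unary.Unique.Propositional using (Unique)
open import Data.Product using (Σ; ∃; _×_)
open import Function.Bundles using (_⇔_)
open import Relation.Binary.PropositionalEquality using (_≡_)

-- 2-adic valuation of m, computed with fuel (fuel m suffices for m ≥ 1).
v2-fuel : ℕ → ℕ → ℕ
v2-fuel zero    m = 0
v2-fuel (suc f) zero = 0
v2-fuel (suc f) (suc k) with (suc k) % 2
... | zero  = suc (v2-fuel f ((suc k) / 2))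
... | suc _ = 0

v2 : ℕ → ℕ
v2 m = v2-fuel m m

ruler : ℕ → ℕ
ruler m = suc (v2 m)

-- "m occurs exactly k times in R (over indices n ≥ 1)":
-- the set {n ≥ 1 | R n ≡ m} is finite and has exactly k elements (k an integer).
OccursExactly : (ℕ → ℕ) → ℕ → ℤ → Set
OccursExactly R m k =
  Σ (List ℕ) λ xs → Unique xs × (+ length xs ≡ k) ×
    (∀ n → 1 ≤ n → (R n ≡ m ⇔ n ∈ xs)) × All (λ n → 1 ≤ n) xs

-- sequences are indexed by n ≥ 1; values at 0 are irrelevant
NondecPos : (ℕ → ℕ) → Set
NondecPos R = (∀ n → 1 ≤ n → 1 ≤ R n) × (∀ m n → 1 ≤ m → m ≤ n → R m ≤ R n)

IsConolly : ℤ → ℤ → (ℕ → ℕ) → Set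
IsConolly α β R =
  NondecPos R × (∀ m → 1 ≤ m → OccursExactly R m (α ℤ.+ β ℤ.* (+ ruler m)))

record MetaFib : Set where
  field
    p  : ℕ
    p≥1 : 1 ≤ p
    s t : ℕ
    a b : Vec ℕ p
    a≥1 : ∀ j → j ∈ toList a → 1 ≤ j
    b≥1 : ∀ j → j ∈ toList b → 1 ≤ j

SatisfiesAt : MetaFib → (ℕ → ℕ) → ℕ → Set
SatisfiesAt F R n =
  (∀ j → j ∈ toList a → j < n) × (∀ j → j ∈ toList b → j < n) ×
  (s + A < n) × (t + B < n) ×
  (R n ≡ R (n ∸ (s + A)) + R (n ∸ (t + B)))
  where
  open MetaFib F
  A = sum (map (λ j → R (n ∸ j)) a)
  B = sum (map (λ j → R (n ∸ j)) b)

-- The recursion is (α,β)-Conolly: for some c and positive initial values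
-- R(1..c), the recursion determines a well-defined solution for all n > c
-- which is (α,β)-Conolly.  (The solution is uniquely determined by the
-- initial values, so we quantify over the whole sequence R.)
IsConollyRecursion : ℤ → ℤ → MetaFib → Set
IsConollyRecursion α β F =
  Σ ℕ λ c → Σ (ℕ → ℕ) λ R →
    (∀ n → c < n → SatisfiesAt F R n) × IsConolly α β R

module Submission where

-- For F = α + β and β ≥ 0, an (α,β)-Conolly sequence is exactly the
-- "block sequence" S in which the value m fills a block of f(m) = F + β·v2(m)
-- consecutive positions (module BlockSequences develops these sequences).
-- Sufficiency: for α = 2q ≥ 2 and for α = −2q' ≤ 0 we give explicit lags
-- (regimes A and B) and verify that S solves the recursion: the value found
-- j positions back plus the number of block boundaries crossed is constant
-- (lookback-sum), which reduces the recursion to offset arithmetic.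
-- Necessity (module ConollyCorrespondence): occurrence counts are lengths, so
-- β ≥ 0 and F ≥ 1; the sequence is then the block sequence, and comparing the
-- growth of both sides of the recursion at n = N(2^E) forces F + β = 2p,
-- hence α = 2(p − β) is even.

module BlockSequences where

  open import Defs
  open import Data.Nat
  open import Data.Nat.Properties
  open import Data.Nat.DivMod using (m/n<m; m*n/n≡m; m*n%n≡0; [m+kn]%n≡m%n)
  open import Data.Nat.Tactic.RingSolver using (solve-∀)
  open import Data.Product using (Σ; _×_; _,_; proj₁; proj₂)
  open import Data.Sum using (_⊎_; inj₁; inj₂)
  open import Data.Empty using (⊥; ⊥-elim)
  open import Data.Vec using (Vec; []; _∷_; map; sum; toList; _++_)
  open import Data.Vec.Relation.Unary.All as AllV using ([]; _∷_) renaming (All to AllV)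
  import Data.Vec.Relation.Unary.All.Properties as AllVₚ
  open import Data.List using (List; []; _∷_; applyUpTo; length)
  open import Data.List.Properties using (length-applyUpTo)
  open import Data.List.Membership.Propositional using (_∈_)
  open import Data.List.Membership.Propositional.Properties using (∈-applyUpTo⁺; ∈-applyUpTo⁻)
  open import Data.List.Relation.Unary.Any using (here; there)
  import Data.List.Relation.Unary.All as All
  open import Data.List.Relation.Unary.AllPairs using ([]; _∷_)
  open import Data.List.Relation.Unary.Unique.Propositional using (Unique)
  open import Data.List.Relation.Unary.Unique.Propositional.Properties using (applyUpTo⁺₁)
  open import Relation.Binary.Definitions using (tri<; tri≈; tri>)
  open import Relation.Binary.PropositionalEquality
  open import Relation.Nullary using (¬_; yes; no)

  -- Doubling as a recursive function, so that parity case splits and the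
  -- fuel-driven computation of v2 in Defs reduce by evaluation.
  dbl : ℕ → ℕ
  dbl zero = zero
  dbl (suc k) = suc (suc (dbl k))

  dbl≡ : ∀ k → dbl k ≡ k * 2
  dbl≡ zero = refl
  dbl≡ (suc k) = cong (λ z → suc (suc z)) (dbl≡ k)

  dbl+ : ∀ k → dbl k ≡ k + k
  dbl+ zero = refl
  dbl+ (suc k) = cong suc (trans (cong suc (dbl+ k)) (sym (+-suc k k)))

  dbl-mono : ∀ k → k ≤ dbl k
  dbl-mono zero = z≤n
  dbl-mono (suc k) = s≤s (≤-trans (dbl-mono k) (n≤1+n _))

  even-or-odd : ∀ w → Σ ℕ λ k → (w ≡ dbl k) ⊎ (w ≡ suc (dbl k))
  even-or-odd zero = 0 , inj₁ refl
  even-or-odd (suc w) with even-or-odd w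
  ... | k , inj₁ e = k , inj₂ (cong suc e)
  ... | k , inj₂ e = suc k , inj₁ (cong suc e)

  v2-fuel-irrelevant : ∀ f g m → m ≤ f → m ≤ g → v2-fuel f m ≡ v2-fuel g m
  v2-fuel-irrelevant zero zero zero _ _ = refl
  v2-fuel-irrelevant zero (suc g) zero _ _ = refl
  v2-fuel-irrelevant (suc f) zero zero _ _ = refl
  v2-fuel-irrelevant (suc f) (suc g) zero _ _ = refl
  v2-fuel-irrelevant (suc f) (suc g) (suc k) (s≤s k≤f) (s≤s k≤g) with suc k % 2
  ... | zero = cong suc (v2-fuel-irrelevant f g (suc k / 2) (≤-trans half≤k k≤f) (≤-trans half≤k k≤g))
    where
    half≤k : suc k / 2 ≤ k
    half≤k = <⇒≤pred (m/n<m (suc k) 2 (s≤s (s≤s z≤n)))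
  ... | suc _ = refl

  v2-odd : ∀ k → v2 (suc (dbl k)) ≡ 0
  v2-odd k with suc (dbl k) % 2 | odd%2
    where
    odd%2 : suc (dbl k) % 2 ≡ 1
    odd%2 rewrite dbl≡ k = [m+kn]%n≡m%n 1 k 2
  ... | suc _ | _ = refl

  v2-even : ∀ k → v2 (dbl (suc k)) ≡ suc (v2 (suc k))
  v2-even k with suc (suc (dbl k)) % 2 | even%2
    where
    even%2 : dbl (suc k) % 2 ≡ 0
    even%2 = subst (λ z → z % 2 ≡ 0) (sym (dbl≡ (suc k))) (m*n%n≡0 (suc k) 2)
  ... | zero | _ = cong suc (trans (cong (v2-fuel (suc (dbl k))) half)
                     (v2-fuel-irrelevant (suc (dbl k)) (suc k) (suc k) (s≤s (dbl-mono k)) ≤-refl))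
    where
    half : dbl (suc k) / 2 ≡ suc k
    half = subst (λ z → z / 2 ≡ suc k) (sym (dbl≡ (suc k))) (m*n/n≡m (suc k) 2)

  dbl≤ : ∀ {a b} → a ≤ b → a + a ≤ b + b
  dbl≤ h = +-mono-≤ h h

  half≤ : ∀ a b → a + a ≤ b + b → a ≤ b
  half≤ a b h with a ≤? b
  ... | yes l = l
  ... | no nl = ⊥-elim (<-irrefl refl (<-≤-trans (+-mono-< (≰⇒> nl) (≰⇒> nl)) h))

  half≤1 : ∀ a b → a + a ≤ suc (b + b) → a ≤ b
  half≤1 a b h with a ≤? b
  ... | yes l = l
  ... | no nl = ⊥-elim (<-irrefl refl (<-≤-trans (s≤s (≤-trans (s≤s (≤-reflexive (sym (+-suc b b)))) (+-mono-≤ (≰⇒> nl) (≰⇒> nl)))) (s≤s h)))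

  half< : ∀ a b → a + a < b + b → a < b
  half< a b h with a <? b
  ... | yes l = l
  ... | no nl = ⊥-elim (<-irrefl refl (<-≤-trans h (dbl≤ (≮⇒≥ nl))))

  half-with-slack : ∀ a b F → 1 ≤ F → a + a ≤ (b + b) + F + 2 → a ≤ b + F
  half-with-slack a b F F≥1 h with a ≤? b + F
  ... | yes l = l
  ... | no nl = ⊥-elim (<-irrefl refl (<-≤-trans lt (≤-trans (dbl≤ (≰⇒> nl)) h)))
    where
    lt : (b + b) + F + 2 < suc (b + F) + suc (b + F)
    lt = subst ((b + b) + F + 2 <_) (r b F) (m<m+n (b + b + F + 2) F≥1)
      where
      r : ∀ b F → (b + b) + F + 2 + F ≡ suc (b + F) + suc (b + F)
      r = solve-∀

  pow2 : ℕ → ℕ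
  pow2 zero = 1
  pow2 (suc J) = dbl (pow2 J)

  pow2≥1 : ∀ J → 1 ≤ pow2 J
  pow2≥1 zero = s≤s z≤n
  pow2≥1 (suc J) = ≤-trans (pow2≥1 J) (dbl-mono (pow2 J))

  pow2-+ : ∀ x y → pow2 (x + y) ≡ pow2 x * pow2 y
  pow2-+ zero y = sym (+-identityʳ (pow2 y))
  pow2-+ (suc x) y = begin
    dbl (pow2 (x + y))             ≡⟨ dbl+ _ ⟩
    pow2 (x + y) + pow2 (x + y)    ≡⟨ cong (λ z → z + z) (pow2-+ x y) ⟩
    pow2 x * pow2 y + pow2 x * pow2 y ≡⟨ sym (*-distribʳ-+ (pow2 y) (pow2 x) (pow2 x)) ⟩
    (pow2 x + pow2 x) * pow2 y     ≡⟨ cong (_* pow2 y) (sym (dbl+ (pow2 x))) ⟩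
    pow2 (suc x) * pow2 y ∎
    where open ≡-Reasoning

  n<pow2n : ∀ J → J < pow2 J
  n<pow2n zero = s≤s z≤n
  n<pow2n (suc J) = begin-strict
    suc J              <⟨ s≤s (n<pow2n J) ⟩
    suc (pow2 J)       ≤⟨ +-monoˡ-≤ (pow2 J) (pow2≥1 J) ⟩
    pow2 J + pow2 J    ≡⟨ sym (dbl+ (pow2 J)) ⟩
    pow2 (suc J) ∎
    where open ≤-Reasoning

  v2-pow2 : ∀ J → v2 (pow2 J) ≡ J
  v2-pow2 zero = v2-odd 0
  v2-pow2 (suc J) with pow2 J | pow2≥1 J | v2-pow2 J
  ... | suc k | _ | ih = trans (v2-even k) (cong suc ih)

  dbl<dbl : ∀ {k m} → dbl k < dbl m → k < m
  dbl<dbl {k} {m} h = half< k m (subst₂ _<_ (dbl+ k) (dbl+ m) h)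

  pow2-dominates : ∀ C D → Σ ℕ λ E → C + D * suc E < pow2 E
  pow2-dominates C D = E , (begin-strict
      C + D * suc E                     ≤⟨ +-mono-≤ C≤M (*-monoˡ-≤ (suc E) D≤M) ⟩
      M + M * suc E                     <⟨ s≤s (m≤m+n _ (M + M)) ⟩
      suc (M + M * suc E) + (M + M)     ≡⟨ sym (square M) ⟩
      suc a * suc a                     ≤⟨ *-mono-≤ (n<pow2n a) (n<pow2n a) ⟩
      pow2 a * pow2 a                   ≡⟨ sym (pow2-+ a a) ⟩
      pow2 E ∎)
    where
    open ≤-Reasoning
    M = C + D + 1
    a = M + M
    E = a + a
    C≤M : C ≤ M
    C≤M = ≤-trans (m≤m+n C D) (m≤m+n (C + D) 1)
    D≤M : D ≤ M
    D≤M = ≤-trans (m≤n+m D C) (m≤m+n (C + D) 1)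
    square : ∀ M → suc (M + M) * suc (M + M) ≡ suc (M + M * suc ((M + M) + (M + M))) + (M + M)
    square = solve-∀

  all-∈ : ∀ {n} {P : ℕ → Set} {xs : Vec ℕ n} → AllV P xs → ∀ j → j ∈ toList xs → P j
  all-∈ (px ∷ _) j (here refl) = px
  all-∈ (_ ∷ pxs) j (there m) = all-∈ pxs j m

  sum-map-+ : ∀ {p} (a : Vec ℕ p) (u w : ℕ → ℕ) →
              sum (map (λ j → u j + w j) a) ≡ sum (map u a) + sum (map w a)
  sum-map-+ [] u w = refl
  sum-map-+ (x ∷ a) u w =
    trans (cong (u x + w x +_) (sum-map-+ a u w)) (shuffle (u x) (w x) (sum (map u a)) (sum (map w a)))
    where
    shuffle : ∀ a b c d → (a + b) + (c + d) ≡ (a + c) + (b + d)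
    shuffle = solve-∀

  sum-const : ∀ {p} (a : Vec ℕ p) (g : ℕ → ℕ) M → (∀ j → j ∈ toList a → g j ≡ M) → sum (map g a) ≡ p * M
  sum-const [] g M _ = refl
  sum-const (x ∷ a) g M H = cong₂ _+_ (H x (here refl)) (sum-const a g M (λ j m → H j (there m)))

  sum-≤ : ∀ {p} (a : Vec ℕ p) (g : ℕ → ℕ) m → (∀ j → j ∈ toList a → g j ≤ m) → sum (map g a) ≤ p * m
  sum-≤ [] g m _ = z≤n
  sum-≤ (x ∷ a) g m H = +-mono-≤ (H x (here refl)) (sum-≤ a g m (λ j mm → H j (there mm)))

  sum-≥ : ∀ {p} (a : Vec ℕ p) (g : ℕ → ℕ) m → (∀ j → j ∈ toList a → m ≤ g j + j) →
          p * m ≤ sum (map g a) + sum a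
  sum-≥ [] g m _ = z≤n
  sum-≥ (x ∷ a) g m H =
    ≤-trans (+-mono-≤ (H x (here refl)) (sum-≥ a g m (λ j mm → H j (there mm))))
            (≤-reflexive (shuffle (g x) x (sum (map g a)) (sum a)))
    where
    shuffle : ∀ a b c d → a + b + (c + d) ≡ a + c + (b + d)
    shuffle = solve-∀

  -- For a lookback j from position i of a
  -- block, count≥ counts how many block boundaries the lookback crosses.
  atLeast : ℕ → ℕ → ℕ
  atLeast v j with v ≤? j
  ... | yes _ = 1
  ... | no _ = 0

  atLeast-yes : ∀ {v j} → v ≤ j → atLeast v j ≡ 1
  atLeast-yes {v} {j} h with v ≤? j
  ... | yes _ = refl
  ... | no nh = ⊥-elim (nh h)

  atLeast-no : ∀ {v j} → j < v → atLeast v j ≡ 0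
  atLeast-no {v} {j} h with v ≤? j
  ... | yes h' = ⊥-elim (<-irrefl refl (<-≤-trans h h'))
  ... | no _ = refl

  atLeast-shift : ∀ c w x → atLeast (c + w) (c + x) ≡ atLeast w x
  atLeast-shift c w x with w ≤? x
  ... | yes h = atLeast-yes (+-monoʳ-≤ c h)
  ... | no h = atLeast-no (+-monoʳ-< c (≰⇒> h))

  count≥ : ∀ {p} → Vec ℕ p → ℕ → ℕ
  count≥ a v = sum (map (atLeast v) a)

  count≥-none : ∀ {p} (a : Vec ℕ p) v → AllV (_< v) a → count≥ a v ≡ 0
  count≥-none [] v _ = refl
  count≥-none (x ∷ a) v (h ∷ r) rewrite atLeast-no h = count≥-none a v r

  count≥-all : ∀ {p} (a : Vec ℕ p) v → AllV (v ≤_) a → count≥ a v ≡ p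
  count≥-all [] v _ = refl
  count≥-all (x ∷ a) v (h ∷ r) rewrite atLeast-yes h = cong suc (count≥-all a v r)

  count≥-++ : ∀ {n m} (xs : Vec ℕ n) (ys : Vec ℕ m) v → count≥ (xs ++ ys) v ≡ count≥ xs v + count≥ ys v
  count≥-++ [] ys v = refl
  count≥-++ (x ∷ xs) ys v =
    trans (cong (atLeast v x +_) (count≥-++ xs ys v)) (sym (+-assoc (atLeast v x) _ _))

  count≥-shift : ∀ {n} c (xs : Vec ℕ n) w → count≥ (map (c +_) xs) (c + w) ≡ count≥ xs w
  count≥-shift c [] w = refl
  count≥-shift c (x ∷ xs) w = cong₂ _+_ (atLeast-shift c w x) (count≥-shift c xs w)

  -- The value m ≥ 1 is to occupy a block of
  -- f m = F + β·v2(m) consecutive positions; N m = f 1 + … + f m is the end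
  -- of the m-th block, and P = F + β.  An (α,β)-Conolly sequence is exactly
  -- the block sequence with F = α + β (see ConollyCorrespondence).
  module Blocks (F β : ℕ) where
    f : ℕ → ℕ
    f m = F + β * v2 m

    N : ℕ → ℕ
    N zero = zero
    N (suc m) = N m + f (suc m)

    P : ℕ
    P = F + β

    f≥F : ∀ m → F ≤ f m
    f≥F m = m≤m+n F _

    f-odd : ∀ k → f (suc (dbl k)) ≡ F
    f-odd k rewrite v2-odd k | *-zeroʳ β = +-identityʳ F

    f-even : ∀ k → f (dbl (suc k)) ≡ f (suc k) + β
    f-even k rewrite v2-even k = rearrange F β (v2 (suc k))
      where
      rearrange : ∀ F β v → F + β * suc v ≡ F + β * v + β
      rearrange = solve-∀

    -- The blocks of 2k+1 and 2k+2 together are those of k+1 plus P.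
    N-even : ∀ k → N (dbl k) ≡ P * k + N k
    N-even zero = sym (trans (+-identityʳ (P * 0)) (*-zeroʳ P))
    N-even (suc k) = begin
        N (dbl k) + f (suc (dbl k)) + f (dbl (suc k))
      ≡⟨ cong₂ (λ u v → u + v + f (dbl (suc k))) (N-even k) (f-odd k) ⟩
        (P * k + N k) + F + f (dbl (suc k))
      ≡⟨ cong (λ v → (P * k + N k) + F + v) (f-even k) ⟩
        (P * k + N k) + F + (f (suc k) + β)
      ≡⟨ rearrange F β (N k) (f (suc k)) k ⟩
        P * suc k + (N k + f (suc k))
      ∎
      where
      open ≡-Reasoning
      rearrange : ∀ F β n g k → ((F + β) * k + n) + F + (g + β) ≡ (F + β) * suc k + (n + g)
      rearrange = solve-∀

    N-mono : ∀ {m m'} → m ≤ m' → N m ≤ N m'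
    N-mono {m} {zero} z≤n = ≤-refl
    N-mono {m} {suc m'} h with m ≟ suc m'
    ... | yes refl = ≤-refl
    ... | no ne = ≤-trans (N-mono {m} {m'} (≤-pred (≤∧≢⇒< h ne))) (m≤m+n _ _)

    N-bounds-even : ∀ L k → (N k ≤ P * k) × (P * k ≤ N k + β * L) →
                    (N (dbl k) ≤ P * dbl k) × (P * dbl k ≤ N (dbl k) + β * suc L)
    N-bounds-even L k (up , lo) = (begin
        N (dbl k)         ≡⟨ N-even k ⟩
        P * k + N k       ≤⟨ +-monoʳ-≤ (P * k) up ⟩
        P * k + P * k     ≡⟨ sym P*dbl ⟩
        P * dbl k ∎) , (begin
        P * dbl k                   ≡⟨ P*dbl ⟩
        P * k + P * k               ≤⟨ +-monoʳ-≤ (P * k) lo ⟩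
        P * k + (N k + β * L)       ≤⟨ +-monoʳ-≤ (P * k) (+-monoʳ-≤ (N k) (*-monoʳ-≤ β (n≤1+n L))) ⟩
        P * k + (N k + β * suc L)   ≡⟨ sym (+-assoc (P * k) (N k) _) ⟩
        P * k + N k + β * suc L     ≡⟨ cong (_+ β * suc L) (sym (N-even k)) ⟩
        N (dbl k) + β * suc L ∎)
      where
      open ≤-Reasoning
      P*dbl : P * dbl k ≡ P * k + P * k
      P*dbl = trans (cong (P *_) (dbl+ k)) (*-distribˡ-+ P k k)
    N-bounds-odd : ∀ L k → (N k ≤ P * k) × (P * k ≤ N k + β * L) →
                   (N (suc (dbl k)) ≤ P * suc (dbl k)) × (P * suc (dbl k) ≤ N (suc (dbl k)) + β * suc L)
    N-bounds-odd L k (up , lo) = (begin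
        N (suc (dbl k))        ≡⟨ N-odd ⟩
        P * k + N k + F        ≤⟨ +-mono-≤ (+-monoʳ-≤ (P * k) up) (m≤m+n F β) ⟩
        P * k + P * k + P      ≡⟨ sym P*odd ⟩
        P * suc (dbl k) ∎) , (begin
        P * suc (dbl k)                   ≡⟨ P*odd ⟩
        P * k + P * k + (F + β)           ≤⟨ +-monoˡ-≤ (F + β) (+-monoʳ-≤ (P * k) lo) ⟩
        P * k + (N k + β * L) + (F + β)   ≡⟨ rearrange (P * k) (N k) F β L ⟩
        P * k + N k + F + β * suc L       ≡⟨ cong (_+ β * suc L) (sym N-odd) ⟩
        N (suc (dbl k)) + β * suc L ∎)
      where
      open ≤-Reasoning
      N-odd : N (suc (dbl k)) ≡ P * k + N k + F
      N-odd = cong₂ _+_ (N-even k) (f-odd k)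
      P*odd : P * suc (dbl k) ≡ P * k + P * k + P
      P*odd = trans (cong (λ z → P * suc z) (dbl+ k)) (distrib P k)
        where
        distrib : ∀ P k → P * suc (k + k) ≡ P * k + P * k + P
        distrib = solve-∀
      rearrange : ∀ a n F β L → a + (n + β * L) + (F + β) ≡ a + n + F + β * suc L
      rearrange = solve-∀

    -- Growth of N: N m ≤ P·m ≤ N m + β·L whenever m < 2^L, by splitting m
    -- into halves; the defect comes from the v2-dependent part of f.
    N-bounds : ∀ L m → m < pow2 L → (N m ≤ P * m) × (P * m ≤ N m + β * L)
    N-bounds zero zero _ = ≤-reflexive (sym (*-zeroʳ P)) , ≤-reflexive (trans (*-zeroʳ P) (sym (*-zeroʳ β)))
    N-bounds zero (suc m) (s≤s ())
    N-bounds (suc L) m lt with even-or-odd m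
    ... | k , inj₁ refl = N-bounds-even L k (N-bounds L k (dbl<dbl lt))
    ... | k , inj₂ refl = N-bounds-odd L k (N-bounds L k (dbl<dbl (<-trans (n<1+n _) lt)))

    -- Position n lies in the block of value m+1.
    InBlock : ℕ → ℕ → Set
    InBlock m n = N m < n × n ≤ N (suc m)

    InBlock-unique : ∀ {m m' n} → InBlock m n → InBlock m' n → m ≡ m'
    InBlock-unique {m} {m'} {n} (a1 , b1) (a2 , b2) with <-cmp m m'
    ... | tri≈ _ e _ = e
    ... | tri< lt _ _ = ⊥-elim (<-irrefl refl (<-≤-trans a2 (≤-trans b1 (N-mono lt))))
    ... | tri> _ _ gt = ⊥-elim (<-irrefl refl (<-≤-trans a1 (≤-trans b2 (N-mono gt))))

    IsBlockSeq : (ℕ → ℕ) → Set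
    IsBlockSeq R = ∀ n → 1 ≤ n → Σ ℕ λ m → (R n ≡ suc m) × InBlock m n

    blockSeq-mono : ∀ {R} → IsBlockSeq R → ∀ m n → 1 ≤ m → m ≤ n → R m ≤ R n
    blockSeq-mono {R} isb m n 1≤m m≤n with isb m 1≤m | isb n (≤-trans 1≤m m≤n)
    ... | u , eu , (lo1 , hi1) | v , ev , (lo2 , hi2) with u ≤? v
    ...   | yes le = subst₂ _≤_ (sym eu) (sym ev) (s≤s le)
    ...   | no nle = ⊥-elim (<-irrefl refl (<-≤-trans lo1 (≤-trans m≤n (≤-trans hi2 (N-mono (≰⇒> nle))))))

    block-value : ∀ {R} → IsBlockSeq R → ∀ {m n} → InBlock m n → R n ≡ suc m
    block-value {R} isb {m} {n} b with isb n (≤-trans (s≤s z≤n) (proj₁ b))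
    ... | m' , e , b' = trans e (cong suc (InBlock-unique b' b))

    block-value-at : ∀ {R} → IsBlockSeq R → ∀ m i → 1 ≤ i → i ≤ f (suc m) → R (N m + i) ≡ suc m
    block-value-at isb m i (s≤s {n = i'} z≤n) i≤f =
      block-value isb (subst (N m <_) (sym (+-suc (N m) i')) (s≤s (m≤m+n (N m) i')) , +-monoʳ-≤ (N m) i≤f)

    block-value-back : ∀ {R} → IsBlockSeq R → ∀ m X j → j < X → X ≤ j + f (suc m) → R (N m + X ∸ j) ≡ suc m
    block-value-back {R} isb m X j j<X X≤ =
      trans (cong R (+-∸-assoc (N m) (<⇒≤ j<X)))
            (block-value-at isb m (X ∸ j) (m<n⇒0<n∸m j<X) (m≤n+o⇒m∸n≤o X j X≤))

    -- Looking back j < i + f(r+2) + f(r+1) positions from offset i in block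
    -- r+3 lands in block r+3, r+2 or r+1; the value found plus the number of
    -- block boundaries crossed is always r+3.
    lookback : ∀ {R} → IsBlockSeq R → ∀ r i j → 1 ≤ i → i ≤ f (suc (suc (suc r))) →
               j < i + f (suc (suc r)) + f (suc r) →
               R (N (suc (suc r)) + i ∸ j) + (atLeast i j + atLeast (i + f (suc (suc r))) j) ≡ suc (suc (suc r))
    lookback {R} isb r i j 1≤i i≤f j< with j <? i
    ... | yes j<i rewrite atLeast-no j<i | atLeast-no {i + f (suc (suc r))} {j} (<-≤-trans j<i (m≤m+n i _))
         = trans (+-identityʳ _) (block-value-back isb (suc (suc r)) i j j<i (≤-trans i≤f (m≤n+m _ j)))
    ... | no j≮i with j <? i + f (suc (suc r))
    ...   | yes j<ig1 rewrite atLeast-yes (≮⇒≥ j≮i) | atLeast-no j<ig1 =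
        trans (cong (λ z → R z + 1) e)
          (trans (cong (_+ 1) (block-value-back isb (suc r) (g1 + i) j (subst (j <_) (+-comm i g1) j<ig1)
                    (subst (g1 + i ≤_) (+-comm g1 j) (+-monoʳ-≤ g1 (≮⇒≥ j≮i)))))
            (+-comm (suc (suc r)) 1))
      where
      g1 = f (suc (suc r))
      e : N (suc (suc r)) + i ∸ j ≡ N (suc r) + (g1 + i) ∸ j
      e = cong (_∸ j) (+-assoc (N (suc r)) g1 i)
    ...   | no j≮ig1 rewrite atLeast-yes (≮⇒≥ j≮i) | atLeast-yes (≮⇒≥ j≮ig1) =
        trans (cong (λ z → R z + 2) e)
          (trans (cong (_+ 2) (block-value-back isb r (g2 + (g1 + i)) j j<X
                    (subst (g2 + (g1 + i) ≤_) (+-comm g2 j) (+-monoʳ-≤ g2 (subst (_≤ j) (+-comm i g1) (≮⇒≥ j≮ig1))))))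
            (+-comm (suc r) 2))
      where
      g1 = f (suc (suc r))
      g2 = f (suc r)
      e : N (suc (suc r)) + i ∸ j ≡ N r + (g2 + (g1 + i)) ∸ j
      e = cong (_∸ j) (trans (+-assoc (N (suc r)) g1 i) (+-assoc (N r) g2 (g1 + i)))
      j<X : j < g2 + (g1 + i)
      j<X = subst (j <_) (trans (+-comm (i + g1) g2) (cong (g2 +_) (+-comm i g1))) j<

    lookback-sum : ∀ {R} → IsBlockSeq R → ∀ {p} (a : Vec ℕ p) r i → 1 ≤ i → i ≤ f (suc (suc (suc r))) →
       (∀ j → j ∈ toList a → j < i + f (suc (suc r)) + f (suc r)) →
       sum (map (λ j → R (N (suc (suc r)) + i ∸ j)) a) + (count≥ a i + count≥ a (i + f (suc (suc r))))
         ≡ p * suc (suc (suc r))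
    lookback-sum {R} isb {p} a r i 1≤i i≤f bnd = begin
        sum (map back a) + (count≥ a i + count≥ a i')
      ≡⟨ cong (sum (map back a) +_) (sym (sum-map-+ a (atLeast i) (atLeast i'))) ⟩
        sum (map back a) + sum (map crossed a)
      ≡⟨ sym (sum-map-+ a back crossed) ⟩
        sum (map (λ j → back j + crossed j) a)
      ≡⟨ sum-const a _ _ (λ j m → lookback isb r i j 1≤i i≤f (bnd j m)) ⟩
        p * suc (suc (suc r)) ∎
      where
      open ≡-Reasoning
      i' = i + f (suc (suc r))
      back : ℕ → ℕ
      back j = R (N (suc (suc r)) + i ∸ j)
      crossed : ℕ → ℕ
      crossed j = atLeast i j + atLeast i' j

    -- Blocks are nonempty once F ≥ 1; then the block sequence exists.
    module NonemptyBlocks (F≥1 : 1 ≤ F) where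
      f≥1 : ∀ m → 1 ≤ f m
      f≥1 m = ≤-trans F≥1 (f≥F m)

      N≥ : ∀ m → m ≤ N m
      N≥ zero = z≤n
      N≥ (suc m) = subst (_≤ N m + f (suc m)) (+-comm m 1) (+-mono-≤ (N≥ m) (f≥1 (suc m)))

      -- position n = (m , i) locates n at offset i past the end of block m.
      advance : ℕ × ℕ → ℕ × ℕ
      advance (m , i) with i <? f (suc m)
      ... | yes _ = m , suc i
      ... | no _ = suc m , 1

      position : ℕ → ℕ × ℕ
      position zero = 0 , 0
      position (suc n) = advance (position n)

      S : ℕ → ℕ
      S n = suc (proj₁ (position n))

      Located : ℕ → ℕ × ℕ → Set
      Located n (m , i) = (n ≡ N m + i) × (i ≤ f (suc m))

      advance-located : ∀ n m i → Located n (m , i) → Located (suc n) (advance (m , i)) × 1 ≤ proj₂ (advance (m , i))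
      advance-located n m i (e , le) with i <? f (suc m)
      ... | yes lt = (trans (cong suc e) (sym (+-suc (N m) i)) , lt) , s≤s z≤n
      ... | no nlt = (trans (cong suc e') (+-comm 1 (N (suc m))) , f≥1 (suc (suc m))) , s≤s z≤n
        where
        e' : n ≡ N (suc m)
        e' = trans e (cong (N m +_) (≤-antisym le (≮⇒≥ nlt)))

      position-located : ∀ n → Located n (position n) × (1 ≤ n → 1 ≤ proj₂ (position n))
      position-located zero = (refl , z≤n) , λ ()
      position-located (suc n) with position n | proj₁ (position-located n)
      ... | (m , i) | loc = proj₁ (advance-located n m i loc) , λ _ → proj₂ (advance-located n m i loc)

      S-isBlockSeq : IsBlockSeq S
      S-isBlockSeq n 1≤n with position n | position-located n
      ... | (m , suc i) | (e , le) , _ =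
        m , refl , (subst (N m <_) (sym e) (subst (N m <_) (sym (+-suc (N m) i)) (s≤s (m≤m+n (N m) i))) ,
                    subst (_≤ N (suc m)) (sym e) (+-monoʳ-≤ (N m) le))
      ... | (m , zero) | _ , pos with pos 1≤n
      ...   | ()

      module _ {R : ℕ → ℕ} (isb : IsBlockSeq R) where
        step-≤1 : ∀ w → 1 ≤ w → R (suc w) ≤ suc (R w)
        step-≤1 w 1≤w with isb w 1≤w | isb (suc w) (s≤s z≤n)
        ... | u , eu , (lo , hi) | v , ev , (lo' , hi') with v ≤? suc u
        ...   | yes le = subst₂ _≤_ (sym ev) (cong suc (sym eu)) (s≤s le)
        ...   | no nle = ⊥-elim (<-irrefl refl (<-≤-trans lo' (begin
                  suc w                        ≤⟨ s≤s hi ⟩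
                  suc n₀                       ≡⟨ +-comm 1 n₀ ⟩
                  n₀ + 1                       ≤⟨ +-monoʳ-≤ n₀ (f≥1 (suc (suc u))) ⟩
                  N (suc (suc u))              ≤⟨ N-mono (≰⇒> nle) ⟩
                  N v ∎)))
          where
          open ≤-Reasoning
          n₀ = N (suc u)
        back-≤ : ∀ a z → a < z → R z ≤ R (z ∸ a) + a
        back-≤ zero z _ = ≤-reflexive (sym (+-identityʳ _))
        back-≤ (suc a) z lt = ≤-trans (back-≤ a z (<-trans (n<1+n a) lt)) (≤-trans (+-monoˡ-≤ a st) (≤-reflexive (sym (+-suc _ a))))
          where
          w = z ∸ suc a
          w1 : suc w ≡ z ∸ a
          w1 = sym (+-∸-assoc 1 (<⇒≤ lt))
          st : R (z ∸ a) ≤ suc (R w)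
          st = subst (λ u → R u ≤ suc (R w)) w1 (step-≤1 w (m<n⇒0<n∸m lt))

  lands-at : ∀ n s A Nk o q I C T → n ≡ T + Nk + I → A + C ≡ T + q → o + q + s ≡ I + C → 1 ≤ o →
             (s + A < n) × (n ∸ (s + A) ≡ Nk + o)
  lands-at n s A Nk o q I C T n≡ sum≡ o≡ o≥1 =
    subst (s + A <_) (sym split) (m<m+n (s + A) (≤-trans o≥1 (m≤n+m o Nk))) ,
    trans (cong (_∸ (s + A)) split) (m+n∸m≡n (s + A) (Nk + o))
    where
    open ≡-Reasoning
    r1 : ∀ s A Nk o C q → s + A + (Nk + o) + (C + q) ≡ Nk + (o + q + s) + (A + C)
    r1 = solve-∀
    r2 : ∀ Nk I C T q → Nk + (I + C) + (T + q) ≡ T + Nk + I + (C + q)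
    r2 = solve-∀
    split : n ≡ (s + A) + (Nk + o)
    split = sym (+-cancelʳ-≡ (C + q) _ _ (begin
      s + A + (Nk + o) + (C + q)   ≡⟨ r1 s A Nk o C q ⟩
      Nk + (o + q + s) + (A + C)   ≡⟨ cong₂ (λ u v → Nk + u + v) o≡ sum≡ ⟩
      Nk + (I + C) + (T + q)       ≡⟨ r2 Nk I C T q ⟩
      T + Nk + I + (C + q)         ≡⟨ cong (_+ (C + q)) (sym n≡) ⟩
      n + (C + q) ∎))

  -- At a position in the block of an odd value
  -- 2k+3 (size F) the two arguments must land in the blocks of k+2 and k+1;
  -- in the block of an even value 2k+4 (size f(k+2) + β) both must land in
  -- the block of k+2.  By lookback-sum, this reduces to the existence of the
  -- offsets recorded in Admissible, which involve only counts of lags.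
  module Verification (F β p : ℕ) (F≥1 : 1 ≤ F) (P≡ : F + β ≡ p + p) where
    open Blocks F β
    open NonemptyBlocks F≥1

    record Admissible (s t : ℕ) (a b : Vec ℕ p) : Set where
      field
        a-bounds : AllV (λ j → 1 ≤ j × j ≤ p + p) a
        b-bounds : AllV (λ j → 1 ≤ j × j ≤ p + p) b
        odd-x : ∀ i → 1 ≤ i → i ≤ F → Σ ℕ λ o → (o + p + s ≡ i + count≥ a i) × 1 ≤ o × o ≤ F
        odd-y : ∀ i → 1 ≤ i → i ≤ F → ∀ g → F ≤ g → Σ ℕ λ o → (o + p + t ≡ g + i + count≥ b i) × 1 ≤ o × o ≤ g
        even-x : ∀ g → F ≤ g → ∀ i → 1 ≤ i → i ≤ g + β →
                 Σ ℕ λ o → (o + (p + p) + s ≡ F + i + (count≥ a i + count≥ a (i + F))) × 1 ≤ o × o ≤ g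
        even-y : ∀ g → F ≤ g → ∀ i → 1 ≤ i → i ≤ g + β →
                 Σ ℕ λ o → (o + (p + p) + t ≡ F + i + (count≥ b i + count≥ b (i + F))) × 1 ≤ o × o ≤ g

    f-even-large : ∀ k → p + p ≤ f (dbl (suc k))
    f-even-large k = subst (_≤ f (dbl (suc k))) P≡ (subst (F + β ≤_) (sym (f-even k)) (+-monoˡ-≤ β (f≥F (suc k))))

    N-dbl : ∀ k → N (dbl (suc k)) ≡ (p + p) * suc k + N (suc k)
    N-dbl k = trans (N-even (suc k)) (cong (λ z → z * suc k + N (suc k)) P≡)

    backSum : (ℕ → ℕ) → ℕ → Vec ℕ p → ℕ
    backSum R n v = sum (map (λ j → R (n ∸ j)) v)

    SolvesAt : ℕ → ℕ → Vec ℕ p → Vec ℕ p → ℕ → Set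
    SolvesAt s t a b n = (s + backSum S n a < n) × (t + backSum S n b < n) ×
                         (S n ≡ S (n ∸ (s + backSum S n a)) + S (n ∸ (t + backSum S n b)))

    lag-small : ∀ (v : Vec ℕ p) → AllV (λ j → 1 ≤ j × j ≤ p + p) v → ∀ k i → 1 ≤ i →
                AllV (_< i + f (dbl (suc k))) v
    lag-small v bounds k i 1≤i =
      AllV.map (λ h → <-≤-trans (s≤s (≤-trans (proj₂ h) (f-even-large k))) (+-monoˡ-≤ _ 1≤i)) bounds

    -- In the block of an odd value 2k+3 a lag crosses at most the boundary at i.
    odd-block-lookback : ∀ k i → 1 ≤ i → i ≤ f (suc (dbl (suc k))) → ∀ (v : Vec ℕ p) → AllV (λ j → 1 ≤ j × j ≤ p + p) v →
                         backSum S (N (dbl (suc k)) + i) v + count≥ v i ≡ (p + p) * suc k + p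
    odd-block-lookback k i 1≤i i≤f v bounds = begin
        backSum S n v + count≥ v i
      ≡⟨ cong (λ z → backSum S n v + z) (sym (+-identityʳ (count≥ v i))) ⟩
        backSum S n v + (count≥ v i + 0)
      ≡⟨ cong (λ z → backSum S n v + (count≥ v i + z)) (sym (count≥-none v (i + f m) small)) ⟩
        backSum S n v + (count≥ v i + count≥ v (i + f m))
      ≡⟨ lookback-sum S-isBlockSeq v (dbl k) i 1≤i i≤f (λ j mem → <-≤-trans (all-∈ small j mem) (m≤m+n _ _)) ⟩
        p * suc m
      ≡⟨ cong (λ z → p * suc z) (dbl+ (suc k)) ⟩
        p * suc (suc k + suc k)
      ≡⟨ distrib p k ⟩
        T + p ∎
      where
      open ≡-Reasoning
      m = dbl (suc k)
      n = N m + i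
      T = (p + p) * suc k
      small = lag-small v bounds k i 1≤i
      distrib : ∀ p k → p * suc (suc k + suc k) ≡ (p + p) * suc k + p
      distrib = solve-∀

    -- In the block of an even value 2k+4 a lag crosses the boundaries at i and i + F.
    even-block-lookback : ∀ k i → 1 ≤ i → i ≤ f (dbl (suc (suc k))) → ∀ (v : Vec ℕ p) → AllV (λ j → 1 ≤ j × j ≤ p + p) v →
                          backSum S (N (suc (dbl (suc k))) + i) v + (count≥ v i + count≥ v (i + F)) ≡ (p + p) * suc k + (p + p)
    even-block-lookback k i 1≤i i≤f v bounds = begin
        backSum S n v + (count≥ v i + count≥ v (i + F))
      ≡⟨ cong (λ z → backSum S n v + (count≥ v i + count≥ v (i + z))) (sym (f-odd (suc k))) ⟩
        backSum S n v + (count≥ v i + count≥ v (i + f m))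
      ≡⟨ lookback-sum S-isBlockSeq v (suc (dbl k)) i 1≤i i≤f
           (λ j mem → <-≤-trans (all-∈ (lag-small v bounds k i 1≤i) j mem) (+-monoˡ-≤ _ (m≤m+n i (f m)))) ⟩
        p * dbl (suc (suc k))
      ≡⟨ cong (p *_) (dbl+ (suc (suc k))) ⟩
        p * (suc (suc k) + suc (suc k))
      ≡⟨ distrib p k ⟩
        T + (p + p) ∎
      where
      open ≡-Reasoning
      m = suc (dbl (suc k))
      n = N m + i
      T = (p + p) * suc k
      distrib : ∀ p k → p * (suc (suc k) + suc (suc k)) ≡ (p + p) * suc k + (p + p)
      distrib = solve-∀

    module _ {s t : ℕ} {a b : Vec ℕ p} (adm : Admissible s t a b) where
      open Admissible adm

      solves-odd-block : ∀ k i → 1 ≤ i → i ≤ F → SolvesAt s t a b (N (dbl (suc k)) + i)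
      solves-odd-block k i 1≤i i≤F = proj₁ xl , proj₁ yl , value
        where
        m = dbl (suc k)
        n = N m + i
        T = (p + p) * suc k
        i≤f : i ≤ f (suc m)
        i≤f = ≤-trans i≤F (f≥F _)
        ox = odd-x i 1≤i i≤F
        oy = odd-y i 1≤i i≤F (f (suc k)) (f≥F _)
        xl = lands-at n s (backSum S n a) (N (suc k)) (proj₁ ox) p i (count≥ a i) T
               (cong (_+ i) (N-dbl k)) (odd-block-lookback k i 1≤i i≤f a a-bounds) (proj₁ (proj₂ ox)) (proj₁ (proj₂ (proj₂ ox)))
        yl = lands-at n t (backSum S n b) (N k) (proj₁ oy) p (f (suc k) + i) (count≥ b i) T
               (trans (cong (_+ i) (N-dbl k)) (rearrange T (N k) (f (suc k)) i)) (odd-block-lookback k i 1≤i i≤f b b-bounds)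
               (proj₁ (proj₂ oy)) (proj₁ (proj₂ (proj₂ oy)))
          where
          rearrange : ∀ T a b i → T + (a + b) + i ≡ T + a + (b + i)
          rearrange = solve-∀
        value : S n ≡ S (n ∸ (s + backSum S n a)) + S (n ∸ (t + backSum S n b))
        value = begin
            S n
          ≡⟨ block-value-at S-isBlockSeq m i 1≤i i≤f ⟩
            suc m
          ≡⟨ cong suc (trans (dbl+ (suc k)) (+-comm (suc k) (suc k))) ⟩
            suc (suc k) + suc k
          ≡⟨ sym (cong₂ _+_ (block-value-at S-isBlockSeq (suc k) _ (proj₁ (proj₂ (proj₂ ox)))
                                (≤-trans (proj₂ (proj₂ (proj₂ ox))) (f≥F _)))
                            (block-value-at S-isBlockSeq k _ (proj₁ (proj₂ (proj₂ oy))) (proj₂ (proj₂ (proj₂ oy))))) ⟩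
            S (N (suc k) + proj₁ ox) + S (N k + proj₁ oy)
          ≡⟨ sym (cong₂ (λ u v → S u + S v) (proj₂ xl) (proj₂ yl)) ⟩
            S (n ∸ (s + backSum S n a)) + S (n ∸ (t + backSum S n b)) ∎
          where open ≡-Reasoning

      solves-even-block : ∀ k i → 1 ≤ i → i ≤ f (dbl (suc (suc k))) → SolvesAt s t a b (N (suc (dbl (suc k))) + i)
      solves-even-block k i 1≤i i≤f = proj₁ xl , proj₁ yl , value
        where
        m = suc (dbl (suc k))
        n = N m + i
        T = (p + p) * suc k
        g = f (suc (suc k))
        i≤gβ : i ≤ g + β
        i≤gβ = subst (i ≤_) (f-even (suc k)) i≤f
        n≡ : n ≡ T + N (suc k) + (F + i)
        n≡ = trans (cong (λ z → N (dbl (suc k)) + z + i) (f-odd (suc k)))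
               (trans (cong (λ z → z + F + i) (N-dbl k)) (rearrange T (N (suc k)) F i))
          where
          rearrange : ∀ T a b i → T + a + b + i ≡ T + a + (b + i)
          rearrange = solve-∀
        ox = even-x g (f≥F _) i 1≤i i≤gβ
        oy = even-y g (f≥F _) i 1≤i i≤gβ
        xl = lands-at n s (backSum S n a) (N (suc k)) (proj₁ ox) (p + p) (F + i) _ T n≡ (even-block-lookback k i 1≤i i≤f a a-bounds)
               (proj₁ (proj₂ ox)) (proj₁ (proj₂ (proj₂ ox)))
        yl = lands-at n t (backSum S n b) (N (suc k)) (proj₁ oy) (p + p) (F + i) _ T n≡ (even-block-lookback k i 1≤i i≤f b b-bounds)
               (proj₁ (proj₂ oy)) (proj₁ (proj₂ (proj₂ oy)))
        value : S n ≡ S (n ∸ (s + backSum S n a)) + S (n ∸ (t + backSum S n b))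
        value = begin
            S n
          ≡⟨ block-value-at S-isBlockSeq m i 1≤i i≤f ⟩
            dbl (suc (suc k))
          ≡⟨ dbl+ (suc (suc k)) ⟩
            suc (suc k) + suc (suc k)
          ≡⟨ sym (cong₂ _+_ (block-value-at S-isBlockSeq (suc k) _ (proj₁ (proj₂ (proj₂ ox))) (proj₂ (proj₂ (proj₂ ox))))
                            (block-value-at S-isBlockSeq (suc k) _ (proj₁ (proj₂ (proj₂ oy))) (proj₂ (proj₂ (proj₂ oy))))) ⟩
            S (N (suc k) + proj₁ ox) + S (N (suc k) + proj₁ oy)
          ≡⟨ sym (cong₂ (λ u v → S u + S v) (proj₂ xl) (proj₂ yl)) ⟩
            S (n ∸ (s + backSum S n a)) + S (n ∸ (t + backSum S n b)) ∎
          where open ≡-Reasoning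

      -- Every position past the block of 3 lies in a block of odd or even
      -- value ≥ 4, so S solves the recursion there.
      solves-after-3 : ∀ n → N 3 < n → SolvesAt s t a b n
      solves-after-3 n N3<n with S-isBlockSeq n (≤-trans (s≤s z≤n) N3<n)
      ... | m , _ , (lo , hi) = subst (SolvesAt s t a b) (m+[n∸m]≡n (<⇒≤ lo)) (by-parity m m≥3 (m<n⇒0<n∸m lo) (m≤n+o⇒m∸n≤o n (N m) hi))
        where
        m≥3 : 3 ≤ m
        m≥3 with 3 ≤? m
        ... | yes h = h
        ... | no h = ⊥-elim (<-irrefl refl (<-≤-trans N3<n (≤-trans hi (N-mono (≰⇒> h)))))
        by-parity : ∀ m → 3 ≤ m → ∀ {i} → 1 ≤ i → i ≤ f (suc m) → SolvesAt s t a b (N m + i)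
        by-parity (suc (suc (suc w))) _ 1≤i i≤ with even-or-odd w
        ... | k , inj₁ refl = solves-even-block k _ 1≤i i≤
        ... | k , inj₂ refl = solves-odd-block (suc k) _ 1≤i (subst (_ ≤_) (f-odd (suc (suc k))) i≤)
        by-parity (suc (suc zero)) (s≤s (s≤s ())) _ _
        by-parity (suc zero) (s≤s ()) _ _

    p≥1 : 1 ≤ p
    p≥1 with p ≟ 0
    ... | no ne = n≢0⇒n>0 ne
    ... | yes e = ⊥-elim (<-irrefl refl (subst (λ z → 0 < z + z) e (subst (0 <_) P≡ (≤-trans F≥1 (m≤m+n F β)))))

    N3-large : p + p ≤ N 3
    N3-large = ≤-trans (f-even-large 0) (≤-trans (m≤n+m (f 2) (0 + f 1)) (m≤m+n (N 2) (f 3)))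

    recursion-of : ∀ {s t a b} → Admissible s t a b → MetaFib
    recursion-of {s} {t} {a} {b} adm = record
      { p = p ; p≥1 = p≥1 ; s = s ; t = t ; a = a ; b = b
      ; a≥1 = λ j m → proj₁ (all-∈ (Admissible.a-bounds adm) j m)
      ; b≥1 = λ j m → proj₁ (all-∈ (Admissible.b-bounds adm) j m) }

    S-satisfies : ∀ {s t a b} (adm : Admissible s t a b) → ∀ n → N 3 < n → SatisfiesAt (recursion-of adm) S n
    S-satisfies adm n N3<n =
      (λ j mem → lag< (proj₂ (all-∈ (Admissible.a-bounds adm) j mem))) ,
      (λ j mem → lag< (proj₂ (all-∈ (Admissible.b-bounds adm) j mem))) ,
      solves-after-3 adm n N3<n
      where
      lag< : ∀ {j} → j ≤ p + p → j < n
      lag< h = ≤-<-trans (≤-trans h N3-large) N3<n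

  descending : ∀ p → Vec ℕ p
  descending zero = []
  descending (suc p) = suc p ∷ descending p

  odds : ∀ p → Vec ℕ p
  odds zero = []
  odds (suc p) = suc (dbl p) ∷ odds p

  descending-bounds : ∀ p → AllV (λ j → 1 ≤ j × j ≤ p) (descending p)
  descending-bounds zero = []
  descending-bounds (suc p) =
    (s≤s z≤n , ≤-refl) ∷ AllV.map (λ h → proj₁ h , ≤-trans (proj₂ h) (n≤1+n p)) (descending-bounds p)

  odds-bounds : ∀ p → AllV (λ j → 1 ≤ j × j < p + p) (odds p)
  odds-bounds zero = []
  odds-bounds (suc p) = (s≤s z≤n , subst (suc (dbl p) <_) (dbl+ (suc p)) (n<1+n _))
    ∷ AllV.map (λ h → proj₁ h , ≤-trans (proj₂ h) (+-mono-≤ (n≤1+n p) (n≤1+n p))) (odds-bounds p)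

  descending-count : ∀ p w → Σ ℕ λ ν → (count≥ (descending p) (suc w) + ν ≡ p) × (ν ≤ w) × (ν < p → ν ≡ w)
  descending-count zero w = 0 , refl , z≤n , λ ()
  descending-count (suc p) w with descending-count p w | w ≤? p
  ... | ν , e , le , imp | yes w≤p rewrite atLeast-yes (s≤s w≤p) = ν , cong suc e , le , imp'
    where
    imp' : ν < suc p → ν ≡ w
    imp' h with ν <? p
    ... | yes lt = imp lt
    ... | no nlt = ≤-antisym le (subst (w ≤_) (sym νp) w≤p)
      where
      νp : ν ≡ p
      νp = ≤-antisym (≤-pred h) (≮⇒≥ nlt)
  ... | ν , e , le , imp | no w≰p rewrite atLeast-no {suc w} {suc p} (s≤s (≰⇒> w≰p)) =
    suc p , cong (_+ suc p) none , ≰⇒> w≰p , λ h → ⊥-elim (<-irrefl refl h)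
    where
    none : count≥ (descending p) (suc w) ≡ 0
    none = count≥-none (descending p) (suc w)
             (AllV.map (λ h → s≤s (≤-trans (proj₂ h) (<⇒≤ (≰⇒> w≰p)))) (descending-bounds p))

  odds-count : ∀ p v → Σ ℕ λ μ → (count≥ (odds p) v + μ ≡ p) × (μ + μ ≤ v) × (μ < p → v ≤ suc (μ + μ))
  odds-count zero v = 0 , refl , z≤n , λ ()
  odds-count (suc p) v with odds-count p v | suc (dbl p) <? v
  ... | μ , e , le , imp | no h' rewrite atLeast-yes (≮⇒≥ h') = μ , cong suc e , le , imp'
    where
    imp' : μ < suc p → v ≤ suc (μ + μ)
    imp' lt with μ <? p
    ... | yes l = imp l
    ... | no nl = subst (λ z → v ≤ suc z) (trans (dbl+ p) (cong₂ _+_ (sym μp) (sym μp))) (≮⇒≥ h')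
      where
      μp : μ ≡ p
      μp = ≤-antisym (≤-pred lt) (≮⇒≥ nl)
  ... | μ , e , le , imp | yes h rewrite atLeast-no {v} {suc (dbl p)} h =
    suc p , cong (_+ suc p) none , subst (_≤ v) (dbl+ (suc p)) h , λ l → ⊥-elim (<-irrefl refl l)
    where
    none : count≥ (odds p) v ≡ 0
    none = count≥-none (odds p) v
             (AllV.map (λ hj → <-trans (proj₂ hj) (subst (_< v) (dbl+ p) (<-trans (n<1+n _) h))) (odds-bounds p))

  -- In each lemma C is a count of lags
  -- and ν (or μ) the complementary number of lags, so C + ν = p; the offset
  -- o is produced explicitly and checked to lie in [1, g].

  odd-x-offset : ∀ p F i C ν → C + ν ≡ p → ν < i → i ≤ F → Σ ℕ λ o → (o + p + 0 ≡ i + C) × 1 ≤ o × o ≤ F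
  odd-x-offset p F i C ν e lt i≤F = i ∸ ν , eq , m<n⇒0<n∸m lt , ≤-trans (m∸n≤m i ν) i≤F
    where
    oν : i ∸ ν + ν ≡ i
    oν = m∸n+n≡m (<⇒≤ lt)
    eq : i ∸ ν + p + 0 ≡ i + C
    eq = begin
        i ∸ ν + p + 0         ≡⟨ cong (λ z → i ∸ ν + z + 0) (sym e) ⟩
        i ∸ ν + (C + ν) + 0   ≡⟨ r (i ∸ ν) C ν ⟩
        (i ∸ ν + ν) + C       ≡⟨ cong (_+ C) oν ⟩
        i + C ∎
      where
      open ≡-Reasoning
      r : ∀ o C ν → o + (C + ν) + 0 ≡ (o + ν) + C
      r = solve-∀

  part≤ : ∀ {C ν p} → C + ν ≡ p → ν ≤ p
  part≤ {C} {ν} e = subst (ν ≤_) e (m≤n+m ν C)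

  odd-y-offsetA : ∀ p q F g i C ν → C + ν ≡ p → ν < i → (ν < p → suc ν ≡ i) → F ≡ p + q → 1 ≤ q → i ≤ F → F ≤ g →
         Σ ℕ λ o → (o + p + q ≡ g + i + C) × 1 ≤ o × o ≤ g
  odd-y-offsetA p q F g i C ν e lt imp eF q≥1 i≤F F≤g = (g ∸ q) + (i ∸ ν) , eq , ≤-trans (m<n⇒0<n∸m lt) (m≤n+m _ _) , up
    where
    q≤g : q ≤ g
    q≤g = ≤-trans (subst (q ≤_) (sym eF) (m≤n+m q p)) F≤g
    iν≤q : i ∸ ν ≤ q
    iν≤q with ν <? p
    ... | yes l = subst (_≤ q) (sym (trans (cong (_∸ ν) (sym (imp l))) (m+n∸n≡m 1 ν))) q≥1
    ... | no nl = ≤-trans (∸-monoʳ-≤ i νp') (≤-trans (∸-monoˡ-≤ p i≤F) (subst (λ z → z ∸ p ≤ q) (sym eF) (≤-reflexive (m+n∸m≡n p q))))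
      where
      νp' : p ≤ ν
      νp' = ≮⇒≥ nl
    up : (g ∸ q) + (i ∸ ν) ≤ g
    up = ≤-trans (+-monoʳ-≤ (g ∸ q) iν≤q) (≤-reflexive (m∸n+n≡m q≤g))
    eq : (g ∸ q) + (i ∸ ν) + p + q ≡ g + i + C
    eq = begin
        (g ∸ q) + (i ∸ ν) + p + q
      ≡⟨ cong (λ z → (g ∸ q) + (i ∸ ν) + z + q) (sym e) ⟩
        (g ∸ q) + (i ∸ ν) + (C + ν) + q
      ≡⟨ r (g ∸ q) (i ∸ ν) C ν q ⟩
        ((g ∸ q) + q) + ((i ∸ ν) + ν) + C
      ≡⟨ cong₂ (λ u v → u + v + C) (m∸n+n≡m q≤g) (m∸n+n≡m (<⇒≤ lt)) ⟩
        g + i + C ∎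
      where
      open ≡-Reasoning
      r : ∀ a b C ν q → a + b + (C + ν) + q ≡ (a + q) + (b + ν) + C
      r = solve-∀

  rest-zero : ∀ p C ν → C + ν ≡ p → p ≤ ν → C ≡ 0
  rest-zero p zero ν e le = refl
  rest-zero p (suc C) ν e le = ⊥-elim (<-irrefl refl (<-≤-trans (s≤s (m≤n+m ν C)) (subst (_≤ ν) (sym e) le)))

  cap-offset : ∀ i g β q p → i ≤ g + β → β + q ≡ p → i ∸ p ≤ g ∸ q
  cap-offset i g β q p le e = ≤-trans (∸-monoˡ-≤ p le) (≤-reflexive (trans (cong ((g + β) ∸_) (sym e)) (trans (cong (_∸ (β + q)) (+-comm g β)) ([m+n]∸[m+o]≡n∸o β g q))))

  -- Both arguments in an even block, in regime A.  Position i and i + F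
  -- give counts C1, C2 with complements ν1, ν2; since i + F > p, C2 = 0.
  module RegimeAEven (p q F g i β C1 ν1 C2 ν2 : ℕ)
    (e1 : C1 + ν1 ≡ p) (lt1 : ν1 < i) (imp1 : ν1 < p → suc ν1 ≡ i)
    (e2 : C2 + ν2 ≡ p) (imp2 : ν2 < p → suc ν2 ≡ i + F)
    (eF : F ≡ p + q) (q≥1 : 1 ≤ q) (F≤g : F ≤ g) (i≤ : i ≤ g + β) (eβ : β + q ≡ p) where

    q≤g : q ≤ g
    q≤g = ≤-trans (subst (q ≤_) (sym eF) (m≤n+m q p)) F≤g

    +-cong₃ : ∀ {a a' b b' c c'} → a ≡ a' → b ≡ b' → c ≡ c' → a + b + c ≡ a' + b' + c'
    +-cong₃ refl refl refl = refl

    C2≡0 : C2 ≡ 0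
    C2≡0 with ν2 <? p
    ... | no nl = rest-zero p C2 ν2 e2 (≮⇒≥ nl)
    ... | yes l = ⊥-elim (<-irrefl refl (<-≤-trans p<F (≤-trans (m≤n+m F i) (≤-trans (≤-reflexive (sym (imp2 l))) l))))
      where
      p<F : p < F
      p<F = subst (p <_) (sym eF) (subst (_≤ p + q) (+-comm p 1) (+-monoʳ-≤ p q≥1))

    iν≤ : ν1 < p → i ∸ ν1 ≡ 1
    iν≤ l = trans (cong (_∸ ν1) (sym (imp1 l))) (m+n∸n≡m 1 ν1)

    νp : ¬ ν1 < p → ν1 ≡ p
    νp nl = ≤-antisym (part≤ e1) (≮⇒≥ nl)

    even-x-offsetA : Σ ℕ λ o → (o + (p + p) + 0 ≡ F + i + (C1 + C2)) × 1 ≤ o × o ≤ g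
    even-x-offsetA = q + (i ∸ ν1) , eq , ≤-trans q≥1 (m≤m+n q _) , up
      where
      eq : q + (i ∸ ν1) + (p + p) + 0 ≡ F + i + (C1 + C2)
      eq = begin
          q + (i ∸ ν1) + (p + p) + 0
        ≡⟨ cong (λ z → q + (i ∸ ν1) + (p + z) + 0) (sym e1) ⟩
          q + (i ∸ ν1) + (p + (C1 + ν1)) + 0
        ≡⟨ r q (i ∸ ν1) p C1 ν1 ⟩
          (p + q) + ((i ∸ ν1) + ν1) + (C1 + 0)
        ≡⟨ +-cong₃ (sym eF) (m∸n+n≡m (<⇒≤ lt1)) (cong (C1 +_) (sym C2≡0)) ⟩
          F + i + (C1 + C2) ∎
        where
        open ≡-Reasoning
        r : ∀ q a p C ν → q + a + (p + (C + ν)) + 0 ≡ (p + q) + (a + ν) + (C + 0)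
        r = solve-∀
      up : q + (i ∸ ν1) ≤ g
      up with ν1 <? p
      ... | yes l = ≤-trans (≤-reflexive (cong (q +_) (iν≤ l))) (≤-trans (subst (q + 1 ≤_) (trans (+-comm q p) (sym eF)) (+-monoʳ-≤ q (≤-trans (s≤s z≤n) l))) F≤g)
      ... | no nl = ≤-trans (+-monoʳ-≤ q (subst (λ z → i ∸ z ≤ g ∸ q) (sym (νp nl)) (cap-offset i g β q p i≤ eβ))) (≤-reflexive (m+[n∸m]≡n q≤g))

    even-y-offsetA : Σ ℕ λ o → (o + (p + p) + q ≡ F + i + (C1 + C2)) × 1 ≤ o × o ≤ g
    even-y-offsetA = i ∸ ν1 , eq , m<n⇒0<n∸m lt1 , up
      where
      eq : (i ∸ ν1) + (p + p) + q ≡ F + i + (C1 + C2)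
      eq = begin
          (i ∸ ν1) + (p + p) + q
        ≡⟨ cong (λ z → (i ∸ ν1) + (p + z) + q) (sym e1) ⟩
          (i ∸ ν1) + (p + (C1 + ν1)) + q
        ≡⟨ r (i ∸ ν1) p C1 ν1 q ⟩
          (p + q) + ((i ∸ ν1) + ν1) + (C1 + 0)
        ≡⟨ +-cong₃ (sym eF) (m∸n+n≡m (<⇒≤ lt1)) (cong (C1 +_) (sym C2≡0)) ⟩
          F + i + (C1 + C2) ∎
        where
        open ≡-Reasoning
        r : ∀ a p C ν q → a + (p + (C + ν)) + q ≡ (p + q) + (a + ν) + (C + 0)
        r = solve-∀
      up : i ∸ ν1 ≤ g
      up with ν1 <? p
      ... | yes l = ≤-trans (≤-reflexive (iν≤ l)) (≤-trans q≥1 q≤g)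
      ... | no nl = ≤-trans (subst (λ z → i ∸ z ≤ g ∸ q) (sym (νp nl)) (cap-offset i g β q p i≤ eβ)) (m∸n≤m g q)

  -- Regime A, α = 2q with q ≥ 1: F = p + q where p = β + q, and the
  -- recursion has s = 0, t = q and lags a = b = (p, …, 1).
  module RegimeA (β q₀ : ℕ) where
    q = suc q₀
    p = β + q
    F = p + q

    F≥1 : 1 ≤ F
    F≥1 = ≤-trans (s≤s z≤n) (m≤n+m q p)

    P≡ : F + β ≡ p + p
    P≡ = r β q
      where
      r : ∀ β q → β + q + q + β ≡ β + q + (β + q)
      r = solve-∀

    open Verification F β p F≥1 P≡

    bounds : AllV (λ j → 1 ≤ j × j ≤ p + p) (descending p)
    bounds = AllV.map (λ h → proj₁ h , ≤-trans (proj₂ h) (m≤m+n p p)) (descending-bounds p)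

    admissible : Admissible 0 q (descending p) (descending p)
    admissible = record
      { a-bounds = bounds
      ; b-bounds = bounds
      ; odd-x = odd-x
      ; odd-y = odd-y
      ; even-x = even-x
      ; even-y = even-y
      }
      where
      odd-x : ∀ i → 1 ≤ i → i ≤ F → Σ ℕ λ o → (o + p + 0 ≡ i + count≥ (descending p) i) × 1 ≤ o × o ≤ F
      odd-x (suc w) _ i≤F with descending-count p w
      ... | ν , e , le , imp = odd-x-offset p F (suc w) _ ν e (s≤s le) i≤F
      odd-y : ∀ i → 1 ≤ i → i ≤ F → ∀ g → F ≤ g → Σ ℕ λ o → (o + p + q ≡ g + i + count≥ (descending p) i) × 1 ≤ o × o ≤ g
      odd-y (suc w) _ i≤F g F≤g with descending-count p w
      ... | ν , e , le , imp = odd-y-offsetA p q F g (suc w) _ ν e (s≤s le) (λ l → cong suc (imp l)) refl (s≤s z≤n) i≤F F≤g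
      even-x : ∀ g → F ≤ g → ∀ i → 1 ≤ i → i ≤ g + β →
              Σ ℕ λ o → (o + (p + p) + 0 ≡ F + i + (count≥ (descending p) i + count≥ (descending p) (i + F))) × 1 ≤ o × o ≤ g
      even-x g F≤g (suc w) _ i≤ with descending-count p w | descending-count p (w + F)
      ... | ν1 , e1 , le1 , imp1 | ν2 , e2 , le2 , imp2 =
        RegimeAEven.even-x-offsetA p q F g (suc w) β _ ν1 _ ν2 e1 (s≤s le1) (λ l → cong suc (imp1 l)) e2 (λ l → cong suc (imp2 l)) refl (s≤s z≤n) F≤g i≤ refl
      even-y : ∀ g → F ≤ g → ∀ i → 1 ≤ i → i ≤ g + β →
              Σ ℕ λ o → (o + (p + p) + q ≡ F + i + (count≥ (descending p) i + count≥ (descending p) (i + F))) × 1 ≤ o × o ≤ g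
      even-y g F≤g (suc w) _ i≤ with descending-count p w | descending-count p (w + F)
      ... | ν1 , e1 , le1 , imp1 | ν2 , e2 , le2 , imp2 =
        RegimeAEven.even-y-offsetA p q F g (suc w) β _ ν1 _ ν2 e1 (s≤s le1) (λ l → cong suc (imp1 l)) e2 (λ l → cong suc (imp2 l)) refl (s≤s z≤n) F≤g i≤ refl

  -- Regime B, α ≤ 0.  The first lags are odd numbers; if μ of them lie
  -- below i, then 2μ ≤ i and so μ < i.
  half<whole : ∀ {μ i} → μ + μ ≤ i → 1 ≤ i → μ < i
  half<whole {zero} {i} _ h = h
  half<whole {suc μ} {i} h _ = ≤-trans (s≤s (m≤n+m (suc μ) μ)) h

  -- First argument in an even block of regime B.  The offset is
  -- (F + i) − (μ1 + μ2), where μ1, μ2 are the numbers of odd lags below i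
  -- and i + F; halving shows it lies in [1, g].
  module RegimeBEvenX (p F g i β C1 μ1 C2 μ2 : ℕ)
    (e1 : C1 + μ1 ≡ p) (h1 : μ1 + μ1 ≤ i) (imp1 : μ1 < p → i ≤ suc (μ1 + μ1))
    (e2 : C2 + μ2 ≡ p) (h2 : μ2 + μ2 ≤ i + F) (imp2 : μ2 < p → i + F ≤ suc (μ2 + μ2))
    (F≥1 : 1 ≤ F) (F≤g : F ≤ g) (i≤ : i ≤ g + β) (eP : F + β ≡ p + p) where

    M = μ1 + μ2
    X = F + i

    M<X : M < X
    M<X = half< M X (begin-strict
        M + M                   ≡⟨ r μ1 μ2 ⟩
        (μ1 + μ1) + (μ2 + μ2)   ≤⟨ +-mono-≤ h1 h2 ⟩
        i + (i + F)             <⟨ m<m+n (i + (i + F)) F≥1 ⟩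
        i + (i + F) + F         ≡⟨ r2 F i ⟩
        X + X ∎)
      where
      open ≤-Reasoning
      r : ∀ a b → (a + b) + (a + b) ≡ (a + a) + (b + b)
      r = solve-∀
      r2 : ∀ F i → i + (i + F) + F ≡ F + i + (F + i)
      r2 = solve-∀

    X≤ : X ≤ g + M
    X≤ with μ2 <? p | μ1 <? p
    ... | yes l2 | yes l1 = ≤-trans (half-with-slack X M F F≥1 (begin
          X + X                                  ≡⟨ r F i ⟩
          (i + F) + i + F                        ≤⟨ +-monoˡ-≤ F (+-monoˡ-≤ i (imp2 l2)) ⟩
          suc (μ2 + μ2) + i + F                  ≤⟨ +-monoˡ-≤ F (+-monoʳ-≤ (suc (μ2 + μ2)) (imp1 l1)) ⟩
          suc (μ2 + μ2) + suc (μ1 + μ1) + F      ≡⟨ r' μ1 μ2 F ⟩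
          M + M + F + 2 ∎)) (≤-trans (+-monoʳ-≤ M F≤g) (≤-reflexive (+-comm M g)))
      where
      open ≤-Reasoning
      r : ∀ F i → (F + i) + (F + i) ≡ (i + F) + i + F
      r = solve-∀
      r' : ∀ a b F → suc (b + b) + suc (a + a) + F ≡ (a + b) + (a + b) + F + 2
      r' = solve-∀
    ... | yes l2 | no nl1 = ⊥-elim (<-irrefl refl contra)
      where
      μ1≡ : μ1 ≡ p
      μ1≡ = ≤-antisym (part≤ e1) (≮⇒≥ nl1)
      h1' : p + p ≤ i
      h1' = subst (λ z → z + z ≤ i) μ1≡ h1
      contra : suc (μ2 + μ2) < suc (μ2 + μ2)
      contra = ≤-trans (≤-reflexive (cong suc (sym (+-suc μ2 μ2)))) (≤-trans (dbl≤ l2) (≤-trans h1' (≤-trans (m≤m+n i F) (imp2 l2))))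
    ... | no nl2 | yes l1 = begin
          F + i                   ≤⟨ +-monoʳ-≤ F (imp1 l1) ⟩
          F + suc (μ1 + μ1)       ≡⟨ r F μ1 ⟩
          (F + μ1) + suc μ1       ≤⟨ +-monoʳ-≤ (F + μ1) l1 ⟩
          F + μ1 + p              ≡⟨ r2 F μ1 p ⟩
          F + (μ1 + p)            ≤⟨ +-monoˡ-≤ (μ1 + p) F≤g ⟩
          g + (μ1 + p)            ≡⟨ cong (λ z → g + (μ1 + z)) (sym μ2≡) ⟩
          g + M ∎
      where
      open ≤-Reasoning
      μ2≡ : μ2 ≡ p
      μ2≡ = ≤-antisym (part≤ e2) (≮⇒≥ nl2)
      r : ∀ F a → F + suc (a + a) ≡ (F + a) + suc a
      r = solve-∀
      r2 : ∀ F a p → F + a + p ≡ F + (a + p)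
      r2 = solve-∀
    ... | no nl2 | no nl1 = ≤-trans (+-monoʳ-≤ F i≤) (≤-reflexive (trans (r F g β) (cong (g +_) (trans eP (cong₂ _+_ (sym μ1≡) (sym μ2≡))))))
      where
      μ2≡ : μ2 ≡ p
      μ2≡ = ≤-antisym (part≤ e2) (≮⇒≥ nl2)
      μ1≡ : μ1 ≡ p
      μ1≡ = ≤-antisym (part≤ e1) (≮⇒≥ nl1)
      r : ∀ F g β → F + (g + β) ≡ g + (F + β)
      r = solve-∀

    even-x-offsetB : Σ ℕ λ o → (o + (p + p) + 0 ≡ F + i + (C1 + C2)) × 1 ≤ o × o ≤ g
    even-x-offsetB = X ∸ M , eq , m<n⇒0<n∸m M<X , m≤n+o⇒m∸n≤o X M (≤-trans X≤ (≤-reflexive (+-comm g M)))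
      where
      eq : X ∸ M + (p + p) + 0 ≡ F + i + (C1 + C2)
      eq = begin
          X ∸ M + (p + p) + 0                    ≡⟨ cong₂ (λ u v → X ∸ M + (u + v) + 0) (sym e1) (sym e2) ⟩
          X ∸ M + ((C1 + μ1) + (C2 + μ2)) + 0    ≡⟨ r (X ∸ M) C1 μ1 C2 μ2 ⟩
          (X ∸ M + M) + (C1 + C2)                ≡⟨ cong (_+ (C1 + C2)) (m∸n+n≡m (<⇒≤ M<X)) ⟩
          X + (C1 + C2) ∎
        where
        open ≡-Reasoning
        r : ∀ o C1 μ1 C2 μ2 → o + ((C1 + μ1) + (C2 + μ2)) + 0 ≡ (o + (μ1 + μ2)) + (C1 + C2)
        r = solve-∀

  even-y-offsetB : ∀ F q' p g u λ1 λ2 D1 D2 → D1 + λ1 ≡ suc q' → D2 + λ2 ≡ suc q' → p + p ≡ F + F + (q' + q') →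
    λ1 + λ2 ≤ u → suc u ≤ g + (λ1 + λ2) →
    Σ ℕ λ o → (o + (p + p) + 1 ≡ F + (F + u) + ((0 + D1) + (0 + D2))) × 1 ≤ o × o ≤ g
  even-y-offsetB F q' p g u λ1 λ2 D1 D2 eD1 eD2 eP L≤u u≤ =
    suc u ∸ L , eq , m<n⇒0<n∸m (s≤s L≤u) , m≤n+o⇒m∸n≤o (suc u) L (≤-trans u≤ (≤-reflexive (+-comm g L)))
    where
    L = λ1 + λ2
    oL : suc u ∸ L + L ≡ suc u
    oL = m∸n+n≡m (≤-trans L≤u (n≤1+n u))
    eq : suc u ∸ L + (p + p) + 1 ≡ F + (F + u) + ((0 + D1) + (0 + D2))
    eq = +-cancelʳ-≡ L _ _ (begin
        suc u ∸ L + (p + p) + 1 + L                ≡⟨ r1 (suc u ∸ L) (p + p) λ1 λ2 ⟩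
        (suc u ∸ L + L) + (p + p) + 1              ≡⟨ cong₂ (λ a b → a + b + 1) oL eP ⟩
        suc u + (F + F + (q' + q')) + 1            ≡⟨ r2 u F q' ⟩
        F + (F + u) + (suc q' + suc q')            ≡⟨ cong (λ z → F + (F + u) + z) (cong₂ _+_ (sym eD1) (sym eD2)) ⟩
        F + (F + u) + ((D1 + λ1) + (D2 + λ2))      ≡⟨ r3 F u D1 D2 λ1 λ2 ⟩
        F + (F + u) + ((0 + D1) + (0 + D2)) + L ∎)
      where
      open ≡-Reasoning
      r1 : ∀ o P a b → o + P + 1 + (a + b) ≡ (o + (a + b)) + P + 1
      r1 = solve-∀
      r2 : ∀ u F q → suc u + (F + F + (q + q)) + 1 ≡ F + (F + u) + (suc q + suc q)
      r2 = solve-∀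
      r3 : ∀ F u D1 D2 a b → F + (F + u) + ((D1 + a) + (D2 + b)) ≡ F + (F + u) + ((0 + D1) + (0 + D2)) + (a + b)
      r3 = solve-∀

  even-y-bounds-small : ∀ F q' g u λ2 → 1 ≤ F → F ≤ g → 1 ≤ u → u ≤ F → λ2 ≤ suc q' →
    (λ2 + λ2 ≤ suc u) → (λ2 < suc q' → suc u ≤ suc (λ2 + λ2)) →
    (0 + λ2 ≤ u) × (suc u ≤ g + (0 + λ2))
  even-y-bounds-small F q' g u λ2 F≥1 F≤g u≥1 u≤F λ2≤ s2 i2 = L≤ , U
    where
    L≤ : λ2 ≤ u
    L≤ = half≤ λ2 u (≤-trans s2 (≤-trans (≤-reflexive (+-comm 1 u)) (+-monoʳ-≤ u u≥1)))
    U : suc u ≤ g + λ2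
    U with λ2 <? suc q'
    ... | yes l2 = ≤-trans (half-with-slack (suc u) λ2 F F≥1 (begin
              suc u + suc u                   ≡⟨ r u ⟩
              u + u + 2                       ≤⟨ +-monoˡ-≤ 2 (+-monoʳ-≤ u u≤F) ⟩
              u + F + 2                       ≤⟨ +-monoˡ-≤ 2 (+-monoˡ-≤ F (≤-pred (i2 l2))) ⟩
              λ2 + λ2 + F + 2 ∎))
            (≤-trans (+-monoʳ-≤ λ2 F≤g) (≤-reflexive (+-comm λ2 g)))
      where
      open ≤-Reasoning
      r : ∀ u → suc u + suc u ≡ u + u + 2
      r = solve-∀
    ... | no nl2 = ≤-trans (s≤s (≤-trans u≤F F≤g)) (≤-trans (≤-reflexive (+-comm 1 g)) (+-monoʳ-≤ g (≤-trans (s≤s z≤n) (≤-reflexive (sym λ2≡)))))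
      where
      λ2≡ : λ2 ≡ suc q'
      λ2≡ = ≤-antisym λ2≤ (≮⇒≥ nl2)

  even-y-bounds-large : ∀ F q' g w β λ1 λ2 → 1 ≤ F → F ≤ g → λ1 ≤ suc q' → λ2 ≤ suc q' →
    (β ≡ F + (q' + q')) → (F + (F + w) ≤ g + β) →
    (λ2 + λ2 ≤ suc (F + w)) → (λ2 < suc q' → suc (F + w) ≤ suc (λ2 + λ2)) →
    (λ1 + λ1 ≤ suc w) → (λ1 < suc q' → suc w ≤ suc (λ1 + λ1)) →
    (λ1 + λ2 ≤ F + w) × (suc (F + w) ≤ g + (λ1 + λ2))
  even-y-bounds-large F q' g w β λ1 λ2 F≥1 F≤g λ1≤ λ2≤ eβ i≤ s2 i2 s1 i1 = L≤ , U
    where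
    L = λ1 + λ2
    u = F + w
    L≤ : L ≤ u
    L≤ = half≤1 L u (begin
          L + L                        ≡⟨ r λ1 λ2 ⟩
          (λ1 + λ1) + (λ2 + λ2)        ≤⟨ +-mono-≤ s1 s2 ⟩
          suc w + suc u                ≤⟨ +-monoˡ-≤ (suc u) (subst (suc w ≤_) (+-comm w F) (≤-trans (≤-reflexive (+-comm 1 w)) (+-monoʳ-≤ w F≥1))) ⟩
          u + suc u                    ≡⟨ +-suc u u ⟩
          suc (u + u) ∎)
      where
      open ≤-Reasoning
      r : ∀ a b → (a + b) + (a + b) ≡ (a + a) + (b + b)
      r = solve-∀
    u≤g2q : u ≤ g + (q' + q')
    u≤g2q = +-cancelˡ-≤ F u (g + (q' + q')) (≤-trans i≤ (≤-reflexive (trans (cong (g +_) eβ) (r g F (q' + q')))))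
      where
      r : ∀ g F x → g + (F + x) ≡ F + (g + x)
      r = solve-∀
    U : suc u ≤ g + L
    U with λ2 <? suc q' | λ1 <? suc q'
    ... | yes l2 | yes l1 = ≤-trans (half-with-slack (suc u) L F F≥1 (begin
              suc (F + w) + suc (F + w)             ≡⟨ r F w ⟩
              (F + w) + w + F + 2                   ≤⟨ +-monoˡ-≤ 2 (+-monoˡ-≤ F (+-mono-≤ (≤-pred (i2 l2)) (≤-pred (i1 l1)))) ⟩
              (λ2 + λ2) + (λ1 + λ1) + F + 2         ≡⟨ r' λ1 λ2 F ⟩
              L + L + F + 2 ∎))
            (≤-trans (+-monoʳ-≤ L F≤g) (≤-reflexive (+-comm L g)))
      where
      open ≤-Reasoning
      r : ∀ F w → suc (F + w) + suc (F + w) ≡ (F + w) + w + F + 2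
      r = solve-∀
      r' : ∀ a b F → (b + b) + (a + a) + F + 2 ≡ (a + b) + (a + b) + F + 2
      r' = solve-∀
    ... | yes l2 | no nl1 = ⊥-elim (<-irrefl refl (begin-strict
            suc q' + suc q'         ≡⟨ cong₂ _+_ (sym λ1≡) (sym λ1≡) ⟩
            λ1 + λ1                 ≤⟨ s1 ⟩
            suc w                   ≤⟨ s≤s (≤-trans (m≤n+m w 1) (+-monoˡ-≤ w F≥1)) ⟩
            suc (F + w)             ≤⟨ i2 l2 ⟩
            suc (λ2 + λ2)           ≤⟨ s≤s (dbl≤ (≤-pred l2)) ⟩
            suc (q' + q')           <⟨ s≤s (≤-reflexive (sym (+-suc q' q'))) ⟩
            suc q' + suc q' ∎))
      where
      open ≤-Reasoning
      λ1≡ : λ1 ≡ suc q'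
      λ1≡ = ≤-antisym λ1≤ (≮⇒≥ nl1)
    ... | no nl2 | yes l1 = begin
              suc (F + w)                   ≤⟨ s≤s (+-monoʳ-≤ F (≤-pred (i1 l1))) ⟩
              suc (F + (λ1 + λ1))           ≤⟨ s≤s (+-monoʳ-≤ F (+-monoʳ-≤ λ1 (≤-pred l1))) ⟩
              suc (F + (λ1 + q'))           ≡⟨ r F λ1 q' ⟩
              F + (λ1 + suc q')             ≡⟨ cong (λ z → F + (λ1 + z)) (sym λ2≡) ⟩
              F + L                         ≤⟨ +-monoˡ-≤ L F≤g ⟩
              g + L ∎
      where
      open ≤-Reasoning
      λ2≡ : λ2 ≡ suc q'
      λ2≡ = ≤-antisym λ2≤ (≮⇒≥ nl2)
      r : ∀ F a q → suc (F + (a + q)) ≡ F + (a + suc q)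
      r = solve-∀
    ... | no nl2 | no nl1 = begin
              suc u                          ≤⟨ s≤s u≤g2q ⟩
              suc (g + (q' + q'))            ≤⟨ n≤1+n _ ⟩
              suc (suc (g + (q' + q')))      ≡⟨ r g q' ⟩
              g + (suc q' + suc q')          ≡⟨ cong (λ z → g + z) (cong₂ _+_ (sym λ1≡) (sym λ2≡)) ⟩
              g + L ∎
      where
      open ≤-Reasoning
      λ2≡ : λ2 ≡ suc q'
      λ2≡ = ≤-antisym λ2≤ (≮⇒≥ nl2)
      λ1≡ : λ1 ≡ suc q'
      λ1≡ = ≤-antisym λ1≤ (≮⇒≥ nl1)
      r : ∀ g q → suc (suc (g + (q + q))) ≡ g + (suc q + suc q)
      r = solve-∀


  -- Regime B: F = F₀ + 1 and β = F + 2q', i.e. α = −2q'.  The recursion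
  -- has s = 0, t = 1, a = odd numbers below 2p, and b = (F₀, …, 1) followed
  -- by the odd numbers shifted by c = 2F₀ + 1, where p = F₀ + q' + 1.
  module RegimeB (F₀ q' : ℕ) where
    F = suc F₀
    p = F₀ + suc q'
    β = F + (q' + q')
    c = suc (dbl F₀)

    F≥1 : 1 ≤ F
    F≥1 = s≤s z≤n

    P≡ : F + β ≡ p + p
    P≡ = r F₀ q'
      where
      r : ∀ F q → suc F + (suc F + (q + q)) ≡ F + suc q + (F + suc q)
      r = solve-∀

    eP : p + p ≡ F + F + (q' + q')
    eP = r F₀ q'
      where
      r : ∀ F q → F + suc q + (F + suc q) ≡ suc F + suc F + (q + q)
      r = solve-∀

    open Verification F β p F≥1 P≡

    shifted-odds : Vec ℕ (suc q')
    shifted-odds = map (c +_) (odds (suc q'))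

    b : Vec ℕ p
    b = descending F₀ ++ shifted-odds

    c+1≡F+F : c + 1 ≡ F + F
    c+1≡F+F = trans (cong (λ z → suc z + 1) (dbl+ F₀)) (r F₀)
      where
      r : ∀ F → suc (F + F) + 1 ≡ suc F + suc F
      r = solve-∀

    shifted-odds-bounds : AllV (λ j → F + F ≤ j × j ≤ p + p) shifted-odds
    shifted-odds-bounds = AllVₚ.map⁺ (AllV.map (λ {j} h → subst (_≤ c + j) c+1≡F+F (+-monoʳ-≤ c (proj₁ h)) , up j h) (odds-bounds (suc q')))
      where
      up : ∀ j → 1 ≤ j × j < suc q' + suc q' → c + j ≤ p + p
      up j (_ , lt) = ≤-trans (+-monoʳ-≤ c (≤-pred (≤-trans lt (≤-reflexive (+-suc (suc q') q'))))) (≤-reflexive (trans (cong (λ z → suc z + suc (q' + q')) (dbl+ F₀)) (r F₀ q')))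
        where
        r : ∀ F q → suc (F + F) + suc (q + q) ≡ F + suc q + (F + suc q)
        r = solve-∀

    descending-none : ∀ v → F₀ < v → count≥ (descending F₀) v ≡ 0
    descending-none v lt = count≥-none (descending F₀) v (AllV.map (λ h → ≤-<-trans (proj₂ h) lt) (descending-bounds F₀))

    shifted-odds-all : ∀ v → v ≤ F + F → count≥ shifted-odds v ≡ suc q'
    shifted-odds-all v le = count≥-all shifted-odds v (AllV.map (λ h → ≤-trans le (proj₁ h)) shifted-odds-bounds)

    count-b : ∀ v → count≥ b v ≡ count≥ (descending F₀) v + count≥ shifted-odds v
    count-b v = count≥-++ (descending F₀) shifted-odds v

    count-shifted-odds : ∀ w → count≥ shifted-odds (c + w) ≡ count≥ (odds (suc q')) w
    count-shifted-odds w = count≥-shift c (odds (suc q')) w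

    descending-complement : ∀ w → suc w ≤ F → count≥ (descending F₀) (suc w) + suc w ≡ F
    descending-complement w le with descending-count F₀ w
    ... | ν , e , νle , imp = trans (+-suc _ w) (cong suc (trans (cong (count≥ (descending F₀) (suc w) +_) (sym νw)) e))
      where
      νw : ν ≡ w
      νw with ν <? F₀
      ... | yes l = imp l
      ... | no nl = ≤-antisym νle (≤-trans (≤-pred le) (≮⇒≥ nl))

    a-bounds : AllV (λ j → 1 ≤ j × j ≤ p + p) (odds p)
    a-bounds = AllV.map (λ h → proj₁ h , <⇒≤ (proj₂ h)) (odds-bounds p)

    b-bounds : AllV (λ j → 1 ≤ j × j ≤ p + p) b
    b-bounds = AllVₚ.++⁺
      (AllV.map (λ h → proj₁ h , ≤-trans (proj₂ h) (≤-trans (m≤m+n F₀ (suc q')) (m≤m+n p p))) (descending-bounds F₀))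
      (AllV.map (λ h → ≤-trans F≥1 (≤-trans (m≤m+n F F) (proj₁ h)) , proj₂ h) shifted-odds-bounds)

    odd-y-equation : ∀ g i C1 D → C1 + i ≡ suc F₀ → D ≡ suc q' → g + p + 1 ≡ g + i + (C1 + D)
    odd-y-equation g i C1 D e refl = sym (trans (r g i C1 q') (trans (cong (λ z → g + z + suc q') e) (r2 g F₀ q')))
      where
      r : ∀ g i C q → g + i + (C + suc q) ≡ g + (C + i) + suc q
      r = solve-∀
      r2 : ∀ g F q → g + suc F + suc q ≡ g + (F + suc q) + 1
      r2 = solve-∀

    even-y-near-equation : ∀ i C1 → C1 + i ≡ suc F₀ → 1 + (p + p) + 1 ≡ suc F₀ + i + ((C1 + suc q') + (0 + suc q'))
    even-y-near-equation i C1 e = sym (trans (r F₀ i C1 q') (trans (cong (λ z → suc F₀ + z + (suc q' + suc q')) e) (r2 F₀ q')))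
      where
      r : ∀ F i C q → suc F + i + ((C + suc q) + (0 + suc q)) ≡ suc F + (C + i) + (suc q + suc q)
      r = solve-∀
      r2 : ∀ F q → suc F + suc F + (suc q + suc q) ≡ 1 + (F + suc q + (F + suc q)) + 1
      r2 = solve-∀

    EvenYOffset : ℕ → ℕ → ℕ → Set
    EvenYOffset g X o = (o + (p + p) + 1 ≡ X) × 1 ≤ o × o ≤ g

    retarget : ∀ {g X Y} → X ≡ Y → Σ ℕ (EvenYOffset g X) → Σ ℕ (EvenYOffset g Y)
    retarget refl h = h

    -- Windows past 2F are read in the shifted odd numbers.
    shift-window : ∀ u → F + u + F ≡ c + suc u
    shift-window u = trans (r F₀ u) (cong (λ z → suc z + suc u) (sym (dbl+ F₀)))
      where
      r : ∀ F u → suc F + u + suc F ≡ suc (F + F) + suc u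
      r = solve-∀

    shift-far-window : ∀ w → F + (F + w) ≡ c + suc w
    shift-far-window w = trans (r F₀ w) (cong (λ z → suc z + suc w) (sym (dbl+ F₀)))
      where
      r : ∀ F w → suc F + (suc F + w) ≡ suc (F + F) + suc w
      r = solve-∀

    count-second-window : ∀ u → Σ ℕ λ λ2 → (count≥ shifted-odds (F + u + F) + λ2 ≡ suc q') × (λ2 + λ2 ≤ suc u) × (λ2 < suc q' → suc u ≤ suc (λ2 + λ2))
    count-second-window u with odds-count (suc q') (suc u)
    ... | λ2 , e , s , i = λ2 , trans (cong (λ z → count≥ shifted-odds z + λ2) (shift-window u)) (trans (cong (_+ λ2) (count-shifted-odds (suc u))) e) , s , i

    even-y-middle : ∀ g → F ≤ g → ∀ u → 1 ≤ u → u ≤ F → Σ ℕ (EvenYOffset g (F + (F + u) + ((0 + count≥ shifted-odds (F + u)) + (0 + count≥ shifted-odds (F + u + F)))))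
    even-y-middle g F≤g u u≥1 u≤F with count-second-window u
    ... | λ2 , e2 , s2 , i2 =
      let D1≡ = shifted-odds-all (F + u) (+-monoʳ-≤ F u≤F)
          cy = even-y-bounds-small F q' g u λ2 F≥1 F≤g u≥1 u≤F (part≤ e2) s2 i2
      in even-y-offsetB F q' p g u 0 λ2 _ _ (trans (+-identityʳ _) D1≡) e2 eP (proj₁ cy) (proj₂ cy)

    even-y-far : ∀ g → F ≤ g → ∀ w → F + (F + w) ≤ g + β →
      Σ ℕ (EvenYOffset g (F + (F + (F + w)) + ((0 + count≥ shifted-odds (F + (F + w))) + (0 + count≥ shifted-odds (F + (F + w) + F)))))
    even-y-far g F≤g w i≤ with count-second-window (F + w) | odds-count (suc q') (suc w)
    ... | λ2 , e2 , s2 , i2 | λ1 , e1 , s1 , i1 =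
      let e1' = trans (cong (λ z → count≥ shifted-odds z + λ1) (shift-far-window w)) (trans (cong (_+ λ1) (count-shifted-odds (suc w))) e1)
          cy = even-y-bounds-large F q' g w β λ1 λ2 F≥1 F≤g (part≤ e1') (part≤ e2) refl i≤ s2 i2 s1 i1
      in even-y-offsetB F q' p g (F + w) λ1 λ2 _ _ e1' e2 eP (proj₁ cy) (proj₂ cy)

    count-b-large : ∀ v → F₀ < v → count≥ b v ≡ 0 + count≥ shifted-odds v
    count-b-large v lt = trans (count-b v) (cong (_+ count≥ shifted-odds v) (descending-none v lt))

    even-y-near : ∀ g → F ≤ g → ∀ w → suc w ≤ F → Σ ℕ (EvenYOffset g (F + suc w + (count≥ b (suc w) + count≥ b (suc w + F))))
    even-y-near g F≤g w le = 1 , eq , s≤s z≤n , ≤-trans F≥1 F≤g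
      where
      C1 = count≥ (descending F₀) (suc w)
      eq : 1 + (p + p) + 1 ≡ F + suc w + (count≥ b (suc w) + count≥ b (suc w + F))
      eq = trans (even-y-near-equation (suc w) C1 (descending-complement w le))
        (cong (λ z → F + suc w + z) (sym (cong₂ _+_
          (trans (count-b (suc w)) (cong (C1 +_) (shifted-odds-all (suc w) (≤-trans le (m≤m+n F F)))))
          (trans (count-b-large (suc w + F) (s≤s (≤-trans (n≤1+n F₀) (m≤n+m F w))))
                 (cong (0 +_) (shifted-odds-all (suc w + F) (+-monoˡ-≤ F le)))))))

    even-y-beyond : ∀ g → F ≤ g → ∀ i → F < i → i ≤ g + β → Σ ℕ (EvenYOffset g (F + i + (count≥ b i + count≥ b (i + F))))
    even-y-beyond g F≤g i F<i i≤ = subst (λ i → i ≤ g + β → Σ ℕ (EvenYOffset g (F + i + (count≥ b i + count≥ b (i + F))))) (sym ie) main i≤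
      where
      u = i ∸ F
      ie : i ≡ F + u
      ie = sym (m+[n∸m]≡n (<⇒≤ F<i))
      u≥1 : 1 ≤ u
      u≥1 = m<n⇒0<n∸m F<i
      main : F + u ≤ g + β → Σ ℕ (EvenYOffset g (F + (F + u) + (count≥ b (F + u) + count≥ b (F + u + F))))
      main i≤' with u ≤? F
      ... | yes u≤F = retarget (cong (λ z → F + (F + u) + z) (sym (cong₂ _+_ (count-b-large (F + u) (m≤m+n F u)) (count-b-large (F + u + F) (≤-trans (m≤m+n F u) (m≤m+n (F + u) F))))))
                        (even-y-middle g F≤g u u≥1 u≤F)
      ... | no nu = subst (λ u → F + u ≤ g + β → Σ ℕ (EvenYOffset g (F + (F + u) + (count≥ b (F + u) + count≥ b (F + u + F))))) (sym ue) big i≤'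
        where
        w = u ∸ F
        ue : u ≡ F + w
        ue = sym (m+[n∸m]≡n (<⇒≤ (≰⇒> nu)))
        big : F + (F + w) ≤ g + β → Σ ℕ (EvenYOffset g (F + (F + (F + w)) + (count≥ b (F + (F + w)) + count≥ b (F + (F + w) + F))))
        big h = retarget (cong (λ z → F + (F + (F + w)) + z) (sym (cong₂ _+_ (count-b-large (F + (F + w)) (m≤m+n F _)) (count-b-large (F + (F + w) + F) (≤-trans (m≤m+n F _) (m≤m+n _ F))))))
                  (even-y-far g F≤g w h)

    admissible : Admissible 0 1 (odds p) b
    admissible = record
      { a-bounds = a-bounds
      ; b-bounds = b-bounds
      ; odd-x = λ i 1≤i i≤F → let sp = odds-count p i in odd-x-offset p F i _ (proj₁ sp) (proj₁ (proj₂ sp)) (half<whole (proj₁ (proj₂ (proj₂ sp))) 1≤i) i≤F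
      ; odd-y = odd-y
      ; even-x = even-x
      ; even-y = even-y
      }
      where
      odd-y : ∀ i → 1 ≤ i → i ≤ F → ∀ g → F ≤ g → Σ ℕ λ o → (o + p + 1 ≡ g + i + count≥ b i) × 1 ≤ o × o ≤ g
      odd-y (suc w) _ le g F≤g = g , equation , ≤-trans F≥1 F≤g , ≤-refl
        where
        equation : g + p + 1 ≡ g + suc w + count≥ b (suc w)
        equation = trans (odd-y-equation g (suc w) _ _ (descending-complement w le) (shifted-odds-all (suc w) (≤-trans le (m≤m+n F F))))
                         (cong (g + suc w +_) (sym (count-b (suc w))))
      even-x : ∀ g → F ≤ g → ∀ i → 1 ≤ i → i ≤ g + β →
              Σ ℕ λ o → (o + (p + p) + 0 ≡ F + i + (count≥ (odds p) i + count≥ (odds p) (i + F))) × 1 ≤ o × o ≤ g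
      even-x g F≤g i 1≤i i≤ with odds-count p i | odds-count p (i + F)
      ... | μ1 , e1 , h1 , imp1 | μ2 , e2 , h2 , imp2 = RegimeBEvenX.even-x-offsetB p F g i β _ μ1 _ μ2 e1 h1 imp1 e2 h2 imp2 F≥1 F≤g i≤ P≡
      even-y : ∀ g → F ≤ g → ∀ i → 1 ≤ i → i ≤ g + β →
              Σ ℕ λ o → (o + (p + p) + 1 ≡ F + i + (count≥ b i + count≥ b (i + F))) × 1 ≤ o × o ≤ g
      even-y g F≤g i 1≤i i≤ with i ≤? F
      even-y g F≤g (suc w) _ i≤ | yes le = even-y-near g F≤g w le
      ... | no nle = even-y-beyond g F≤g i (≰⇒> nle) i≤


  -- At n = N(2^E) the
  -- recursion gives 2n = x + y + (s + t) + A + B with R x + R y = 2^E and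
  -- A, B ≈ p·2^E; as n ≈ P·2^E and x + y ≈ P·2^E up to errors linear in E,
  -- comparing both sides for large E forces P = 2p.
  module Asymptotics (F β : ℕ) (F≥1 : 1 ≤ F) where
    open Blocks F β
    open NonemptyBlocks F≥1

    module _ {R : ℕ → ℕ} (isb : IsBlockSeq R) where
      index≤P*value : ∀ z → 1 ≤ z → z ≤ P * R z
      index≤P*value z 1≤z with isb z 1≤z
      ... | u , eu , (lo , hi) = ≤-trans hi (≤-trans (proj₁ (N-bounds (suc u) (suc u) (n<pow2n (suc u)))) (≤-reflexive (cong (P *_) (sym eu))))

      P*value≤index : ∀ L z → 1 ≤ z → R z ≤ pow2 L → P * R z ≤ z + P + β * L
      P*value≤index L z 1≤z le with isb z 1≤z
      ... | u , eu , (lo , hi) = begin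
          P * R z              ≡⟨ cong (P *_) eu ⟩
          P * suc u            ≡⟨ *-suc P u ⟩
          P + P * u            ≤⟨ +-monoʳ-≤ P (proj₂ (N-bounds L u (subst (_≤ pow2 L) eu le))) ⟩
          P + (N u + β * L)    ≤⟨ +-monoʳ-≤ P (+-monoˡ-≤ (β * L) (<⇒≤ lo)) ⟩
          P + (z + β * L)      ≡⟨ r P z (β * L) ⟩
          z + P + β * L ∎
        where
        open ≤-Reasoning
        r : ∀ P z x → P + (z + x) ≡ z + P + x
        r = solve-∀

      -- Evaluate the recursion at n = N m, the end of the block of m = 2^E,
      -- with E so large that 2^E exceeds every error term (pow2-dominates).
      module AtPowerOfTwo (Mf : MetaFib) (c : ℕ) (rec : ∀ n → c < n → SatisfiesAt Mf R n) where
        open MetaFib Mf renaming (a to av; b to bv)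
        C = c + s + t + (P + P) + sum av + sum bv
        D = β + β
        dominates = pow2-dominates C D
        E = proj₁ dominates
        hE : C + D * suc E < pow2 E
        hE = proj₂ dominates
        m = pow2 E
        n = N m
        c≤C : c ≤ C
        c≤C = ≤-trans (m≤m+n c s) (≤-trans (m≤m+n _ t) (≤-trans (m≤m+n _ (P + P)) (≤-trans (m≤m+n _ (sum av)) (m≤m+n _ (sum bv)))))
        c<n : c < n
        c<n = ≤-trans (s≤s (≤-trans c≤C (m≤m+n C (D * suc E)))) (≤-trans hE (N≥ m))
        sat = rec n c<n
        A = sum (map (λ j → R (n ∸ j)) av)
        B = sum (map (λ j → R (n ∸ j)) bv)
        ja : ∀ j → j ∈ toList av → j < n
        ja = proj₁ sat
        jb : ∀ j → j ∈ toList bv → j < n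
        jb = proj₁ (proj₂ sat)
        xs : s + A < n
        xs = proj₁ (proj₂ (proj₂ sat))
        ys : t + B < n
        ys = proj₁ (proj₂ (proj₂ (proj₂ sat)))
        x = n ∸ (s + A)
        y = n ∸ (t + B)
        req : R n ≡ R x + R y
        req = proj₂ (proj₂ (proj₂ (proj₂ sat)))
        xe : x + (s + A) ≡ n
        xe = m∸n+n≡m (<⇒≤ xs)
        ye : y + (t + B) ≡ n
        ye = m∸n+n≡m (<⇒≤ ys)
        x≥1 : 1 ≤ x
        x≥1 = m<n⇒0<n∸m xs
        y≥1 : 1 ≤ y
        y≥1 = m<n⇒0<n∸m ys
        Rn : R n ≡ m
        Rn with m | pow2≥1 E
        ... | suc m' | _ = block-value-at isb m' (f (suc m')) (f≥1 (suc m')) ≤-refl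
        Rx+Ry : R x + R y ≡ m
        Rx+Ry = trans (sym req) Rn
        Rle : ∀ z → 1 ≤ z → z ≤ n → R z ≤ m
        Rle z 1≤z zn = subst (R z ≤_) Rn (blockSeq-mono isb z n 1≤z zn)
        Ale : A ≤ p * m
        Ale = sum-≤ av (λ j → R (n ∸ j)) m (λ j mem → Rle (n ∸ j) (m<n⇒0<n∸m (ja j mem)) (m∸n≤m n j))
        Ble : B ≤ p * m
        Ble = sum-≤ bv (λ j → R (n ∸ j)) m (λ j mem → Rle (n ∸ j) (m<n⇒0<n∸m (jb j mem)) (m∸n≤m n j))
        Age : p * m ≤ A + sum av
        Age = sum-≥ av (λ j → R (n ∸ j)) m (λ j mem → subst (_≤ R (n ∸ j) + j) Rn (back-≤ isb j n (ja j mem)))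
        Bge : p * m ≤ B + sum bv
        Bge = sum-≥ bv (λ j → R (n ∸ j)) m (λ j mem → subst (_≤ R (n ∸ j) + j) Rn (back-≤ isb j n (jb j mem)))
        mlt : m < pow2 (suc E)
        mlt = subst (m <_) (sym (dbl+ m)) (m<m+n m (pow2≥1 E))
        nle : n ≤ P * m
        nle = proj₁ (N-bounds (suc E) m mlt)
        Pmle : P * m ≤ n + β * suc E
        Pmle = proj₂ (N-bounds (suc E) m mlt)
        PRm : P * R x + P * R y ≡ P * m
        PRm = trans (sym (*-distribˡ-+ P (R x) (R y))) (cong (P *_) Rx+Ry)

        open ≤-Reasoning

        xy : x + y ≤ P * m
        xy = ≤-trans (+-mono-≤ (index≤P*value x x≥1) (index≤P*value y y≥1)) (≤-reflexive PRm)

        nn : n + n ≡ (x + y) + (s + t) + (A + B)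
        nn = trans (cong₂ _+_ (sym xe) (sym ye)) (r x s A y t B)
          where
          r : ∀ x s A y t B → x + (s + A) + (y + (t + B)) ≡ (x + y) + (s + t) + (A + B)
          r = solve-∀

        pm = p * m
        βJ = β * suc E

        DJ : D * suc E ≡ βJ + βJ
        DJ = *-distribʳ-+ (suc E) β β

        -- If 2p < P, then P m ≤ 2p m + O(E), contradicting the choice of E …
        big : p + p < P → ⊥
        big lt = <-irrefl refl (<-≤-trans hE mbound)
          where
          step1 : P * m + P * m ≤ P * m + ((s + t) + (pm + pm) + (βJ + βJ))
          step1 = begin
              P * m + P * m                      ≤⟨ +-mono-≤ Pmle Pmle ⟩
              (n + βJ) + (n + βJ)                ≡⟨ r n βJ ⟩
              (n + n) + (βJ + βJ)                ≡⟨ cong (_+ (βJ + βJ)) nn ⟩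
              (x + y) + (s + t) + (A + B) + (βJ + βJ)  ≤⟨ +-monoˡ-≤ (βJ + βJ) (+-mono-≤ (+-monoˡ-≤ (s + t) xy) (+-mono-≤ Ale Ble)) ⟩
              P * m + (s + t) + (pm + pm) + (βJ + βJ)  ≡⟨ r2 (P * m) (s + t) (pm + pm) (βJ + βJ) ⟩
              P * m + ((s + t) + (pm + pm) + (βJ + βJ)) ∎
            where
            r : ∀ n b → (n + b) + (n + b) ≡ (n + n) + (b + b)
            r = solve-∀
            r2 : ∀ a b c d → a + b + c + d ≡ a + (b + c + d)
            r2 = solve-∀
          step2 : P * m ≤ (s + t) + (pm + pm) + (βJ + βJ)
          step2 = +-cancelˡ-≤ (P * m) _ _ step1
          step3 : (pm + pm) + m ≤ (pm + pm) + ((s + t) + (βJ + βJ))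
          step3 = begin
              (pm + pm) + m            ≡⟨ r p m ⟩
              suc (p + p) * m          ≤⟨ *-monoˡ-≤ m lt ⟩
              P * m                    ≤⟨ step2 ⟩
              (s + t) + (pm + pm) + (βJ + βJ)   ≡⟨ r2 (s + t) (pm + pm) (βJ + βJ) ⟩
              (pm + pm) + ((s + t) + (βJ + βJ)) ∎
            where
            r : ∀ p m → (p * m + p * m) + m ≡ suc (p + p) * m
            r = solve-∀
            r2 : ∀ a b c → a + b + c ≡ b + (a + c)
            r2 = solve-∀
          mbound : m ≤ C + D * suc E
          mbound = ≤-trans (+-cancelˡ-≤ (pm + pm) _ _ step3)
            (+-mono-≤ (≤-trans (m≤n+m (s + t) c) (≤-trans (≤-reflexive (sym (+-assoc c s t))) (≤-trans (m≤m+n _ (P + P)) (≤-trans (m≤m+n _ (sum av)) (m≤m+n _ (sum bv))))))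
                      (≤-reflexive (sym DJ)))

        -- … and if P < 2p, then 2p m ≤ P m + O(E), likewise.
        small : P < p + p → ⊥
        small lt = <-irrefl refl (<-≤-trans hE mbound)
          where
          βj = β * E
          K = (P + P) + (βj + βj) + (sum av + sum bv)
          PRx : P * R x ≤ x + P + βj
          PRx = P*value≤index E x x≥1 (Rle x x≥1 (m∸n≤m n (s + A)))
          PRy : P * R y ≤ y + P + βj
          PRy = P*value≤index E y y≥1 (Rle y y≥1 (m∸n≤m n (t + B)))
          xyAB : (x + y) + (A + B) ≤ n + n
          xyAB = begin
              (x + y) + (A + B)                   ≤⟨ m≤n+m _ (s + t) ⟩
              (s + t) + ((x + y) + (A + B))       ≡⟨ r (s + t) (x + y) (A + B) ⟩
              (x + y) + (s + t) + (A + B)         ≡⟨ sym nn ⟩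
              n + n ∎
            where
            r : ∀ a b c → a + (b + c) ≡ b + a + c
            r = solve-∀
          step1 : P * m + (pm + pm) ≤ (P * m + P * m) + K
          step1 = begin
              P * m + (pm + pm)                                  ≤⟨ +-mono-≤ (≤-trans (≤-reflexive (sym PRm)) (+-mono-≤ PRx PRy)) (+-mono-≤ Age Bge) ⟩
              (x + P + βj) + (y + P + βj) + ((A + sum av) + (B + sum bv))  ≡⟨ r x y P βj A B (sum av) (sum bv) ⟩
              ((x + y) + (A + B)) + K                            ≤⟨ +-monoˡ-≤ K xyAB ⟩
              (n + n) + K                                        ≤⟨ +-monoˡ-≤ K (+-mono-≤ nle nle) ⟩
              (P * m + P * m) + K ∎
            where
            r : ∀ x y P b A B a' b' → (x + P + b) + (y + P + b) + ((A + a') + (B + b')) ≡ ((x + y) + (A + B)) + ((P + P) + (b + b) + (a' + b'))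
            r = solve-∀
          step2 : pm + pm ≤ P * m + K
          step2 = +-cancelˡ-≤ (P * m) _ _ (≤-trans step1 (≤-reflexive (+-assoc (P * m) (P * m) K)))
          step3 : P * m + m ≤ P * m + K
          step3 = begin
              P * m + m        ≡⟨ r P m ⟩
              suc P * m        ≤⟨ *-monoˡ-≤ m lt ⟩
              (p + p) * m      ≡⟨ *-distribʳ-+ m p p ⟩
              pm + pm          ≤⟨ step2 ⟩
              P * m + K ∎
            where
            r : ∀ P m → P * m + m ≡ suc P * m
            r = solve-∀
          mbound : m ≤ C + D * suc E
          mbound = ≤-trans (+-cancelˡ-≤ (P * m) _ _ step3) (begin
              (P + P) + (βj + βj) + (sum av + sum bv)        ≡⟨ r (P + P) (βj + βj) (sum av) (sum bv) ⟩
              ((P + P) + sum av + sum bv) + (βj + βj)        ≤⟨ +-mono-≤ (+-monoˡ-≤ (sum bv) (+-monoˡ-≤ (sum av) (m≤n+m (P + P) (c + s + t)))) (+-mono-≤ bJ bJ) ⟩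
              C + (βJ + βJ)                                  ≡⟨ cong (C +_) (sym DJ) ⟩
              C + D * suc E ∎)
            where
            r : ∀ a b c d → a + b + (c + d) ≡ a + c + d + b
            r = solve-∀
            bJ : βj ≤ βJ
            bJ = *-monoʳ-≤ β (n≤1+n E)

      forced-order : (Mf : MetaFib) (c : ℕ) → (∀ n → c < n → SatisfiesAt Mf R n) → P ≡ MetaFib.p Mf + MetaFib.p Mf
      forced-order Mf c rec with <-cmp P (MetaFib.p Mf + MetaFib.p Mf)
      ... | tri≈ _ e _ = e
      ... | tri< lt _ _ = ⊥-elim (AtPowerOfTwo.small Mf c rec lt)
      ... | tri> _ _ gt = ⊥-elim (AtPowerOfTwo.big Mf c rec gt)

  remove : ℕ → List ℕ → List ℕ
  remove x [] = []
  remove x (z ∷ zs) with x ≟ z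
  ... | yes _ = zs
  ... | no _ = z ∷ remove x zs

  remove-length : ∀ {x} zs → x ∈ zs → suc (length (remove x zs)) ≡ length zs
  remove-length {x} (z ∷ zs) mem with x ≟ z
  ... | yes _ = refl
  remove-length {x} (z ∷ zs) (here e) | no ne = ⊥-elim (ne e)
  remove-length {x} (z ∷ zs) (there mem) | no ne = cong suc (remove-length zs mem)

  remove-keeps : ∀ {x y} zs → y ∈ zs → y ≢ x → y ∈ remove x zs
  remove-keeps {x} {y} (z ∷ zs) mem ne with x ≟ z
  remove-keeps {x} {y} (z ∷ zs) (here refl) ne | yes refl = ⊥-elim (ne refl)
  remove-keeps {x} {y} (z ∷ zs) (there mem) ne | yes _ = mem
  remove-keeps {x} {y} (z ∷ zs) (here e) ne | no _ = here e
  remove-keeps {x} {y} (z ∷ zs) (there mem) ne | no _ = there (remove-keeps zs mem ne)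

  unique-length-≤ : ∀ ys zs → Unique ys → (∀ {y} → y ∈ ys → y ∈ zs) → length ys ≤ length zs
  unique-length-≤ [] zs _ _ = z≤n
  unique-length-≤ (y ∷ ys) zs (h ∷ u) sub =
    subst (suc (length ys) ≤_) (remove-length zs (sub (here refl)))
      (s≤s (unique-length-≤ ys (remove y zs) u (λ {y'} m → remove-keeps zs (sub (there m)) (λ e → All.lookup h m (sym e)))))

  interval : ℕ → ℕ → List ℕ
  interval lo k = applyUpTo (λ i → lo + i) k

  interval-unique : ∀ lo k → Unique (interval lo k)
  interval-unique lo k = applyUpTo⁺₁ (λ i → lo + i) k (λ {i} {j} i<j _ e → <-irrefl (+-cancelˡ-≡ lo _ _ e) i<j)

  interval-length : ∀ lo k → length (interval lo k) ≡ k
  interval-length lo k = length-applyUpTo (λ i → lo + i) k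

  interval-∈ : ∀ lo k x → lo ≤ x → x < lo + k → x ∈ interval lo k
  interval-∈ lo k x le lt = subst (_∈ interval lo k) (m+[n∸m]≡n le) (∈-applyUpTo⁺ (λ i → lo + i) (+-cancelˡ-< lo _ _ (subst (_< lo + k) (sym (m+[n∸m]≡n le)) lt)))

  ∈-interval : ∀ lo k x → x ∈ interval lo k → lo ≤ x × x < lo + k
  ∈-interval lo k x mem with ∈-applyUpTo⁻ (λ i → lo + i) mem
  ... | i , lt , refl = m≤m+n lo i , +-monoʳ-< lo lt

module ConollyCorrespondence where

  open import Defs
  open BlockSequences
  open import Data.Nat
  open import Data.Nat.Properties
  open import Data.Nat.Tactic.RingSolver using (solve-∀)
  import Data.Nat.Divisibility as ℕ
  open import Data.Integer as ℤ using (ℤ; +_; -[1+_]; +≤+; +<+; -≤+)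
  import Data.Integer.Properties as ℤP
  open import Data.Integer.Divisibility using (_∣_)
  open import Data.Product using (Σ; _×_; _,_; proj₁; proj₂)
  open import Data.Empty using (⊥-elim)
  open import Data.List using ([]; _∷_; length)
  open import Data.List.Membership.Propositional using (_∈_)
  open import Data.List.Relation.Unary.Any using (here)
  import Data.List.Relation.Unary.All as All
  open import Data.List.Relation.Unary.Unique.Propositional using (Unique)
  open import Function.Bundles using (_⇔_; mk⇔; Equivalence)
  open import Relation.Binary.PropositionalEquality
  open import Relation.Nullary using (¬_; yes; no)

  ⊖≡+ : ∀ b c k → b ℤ.⊖ c ≡ + k → b ≡ c + k
  ⊖≡+ b c k e with c ≤? b
  ... | yes le = trans (sym (m+[n∸m]≡n le)) (cong (λ z → c + z) (ℤP.+-injective (trans (sym (ℤP.⊖-≥ le)) e)))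
  ... | no nle with c ∸ b | m<n⇒0<n∸m (≰⇒> nle) | trans (sym (ℤP.⊖-< (≰⇒> nle))) e
  ...   | suc _ | _ | ()

  0<⊖ : ∀ m n → + 0 ℤ.< m ℤ.⊖ n → n < m
  0<⊖ m n h with n <? m
  ... | yes l = l
  ... | no nl = ⊥-elim (ℤP.<-irrefl refl (ℤP.<-≤-trans h (subst (ℤ._≤ + 0) (sym (ℤP.⊖-≤ (≮⇒≥ nl))) (-n≤0 (n ∸ m)))))
    where
    -n≤0 : ∀ n → ℤ.- (+ n) ℤ.≤ + 0
    -n≤0 zero = +≤+ z≤n
    -n≤0 (suc n) = -≤+

  conolly-count : ∀ α b F → α ℤ.+ + b ≡ + F → ∀ m → α ℤ.+ + b ℤ.* + ruler m ≡ + Blocks.f F b m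
  conolly-count α b F eF m = begin
      α ℤ.+ (+ b) ℤ.* (+ suc v)        ≡⟨ cong (λ z → α ℤ.+ z) (sym (ℤP.pos-* b (suc v))) ⟩
      α ℤ.+ + (b * suc v)              ≡⟨ cong (λ z → α ℤ.+ + z) (*-suc b v) ⟩
      α ℤ.+ (+ b ℤ.+ + (b * v))        ≡⟨ sym (ℤP.+-assoc α (+ b) (+ (b * v))) ⟩
      (α ℤ.+ + b) ℤ.+ + (b * v)        ≡⟨ cong (ℤ._+ + (b * v)) eF ⟩
      + (F + b * v) ∎
    where
    open ≡-Reasoning
    v = v2 m

  S-occurrences : ∀ F β (F≥1 : 1 ≤ F) m →
                  OccursExactly (Blocks.NonemptyBlocks.S F β F≥1) (suc m) (+ Blocks.f F β (suc m))
  S-occurrences F β F≥1 m =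
    positions , interval-unique _ _ , cong +_ (interval-length _ _) , (λ n 1≤n → mk⇔ (to n 1≤n) from) ,
    All.tabulate (λ mem → ≤-trans (s≤s z≤n) (proj₁ (∈-interval _ _ _ mem)))
    where
    open Blocks F β
    open NonemptyBlocks F≥1
    positions = interval (suc (N m)) (f (suc m))
    to : ∀ n → 1 ≤ n → S n ≡ suc m → n ∈ positions
    to n 1≤n e with S-isBlockSeq n 1≤n
    ... | u , eu , (lo , hi) with suc-injective (trans (sym eu) e)
    ...   | refl = interval-∈ (suc (N u)) (f (suc u)) n lo (s≤s hi)
    from : ∀ {n} → n ∈ positions → S n ≡ suc m
    from mem with ∈-interval _ _ _ mem
    ... | lo , hi = block-value S-isBlockSeq (lo , ≤-pred hi)

  recursion-from-admissible : ∀ {F b p} (F≥1 : 1 ≤ F) (P≡ : F + b ≡ p + p) α {β} → α ℤ.+ + b ≡ + F → + b ≡ β →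
    ∀ {s t a a'} → Verification.Admissible F b p F≥1 P≡ s t a a' → Σ MetaFib (IsConollyRecursion α β)
  recursion-from-admissible {F} {b} {p} F≥1 P≡ α eF refl adm =
    recursion-of adm , N 3 , S , S-satisfies adm , ((λ n _ → s≤s z≤n) , blockSeq-mono S-isBlockSeq) , occurrences
    where
    open Blocks F b
    open NonemptyBlocks F≥1
    open Verification F b p F≥1 P≡
    occurrences : ∀ m → 1 ≤ m → OccursExactly S m (α ℤ.+ + b ℤ.* + ruler m)
    occurrences (suc m) _ = subst (OccursExactly S (suc m)) (sym (conolly-count α b F eF (suc m))) (S-occurrences F b F≥1 m)

  -- α = 2q ≥ 2 is regime A; α = 0 is regime B with q' = 0; α = −2q' < 0
  -- (then β > −α by α + β > 0) is regime B with F = α + β.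
  sufficiency : (α β : ℤ) → (+ 0 ℤ.≤ β) × (+ 0 ℤ.< α ℤ.+ β) × (+ 2 ∣ α) → Σ MetaFib (IsConollyRecursion α β)
  sufficiency α -[1+ _ ] (() , _)
  sufficiency (+ a) (+ b) (_ , _ , ℕ.divides (suc q₀) a≡) =
    recursion-from-admissible F≥1 P≡ (+ a) (cong +_ (sym F≡)) refl admissible
    where
    open RegimeA b q₀ using (F; F≥1; P≡; admissible)
    F≡ : F ≡ a + b
    F≡ = trans (rearrange b q₀) (cong (λ z → z + b) (sym a≡))
      where
      rearrange : ∀ b q → b + suc q + suc q ≡ suc q * 2 + b
      rearrange = solve-∀
  sufficiency (+ a) (+ zero) (_ , pos , ℕ.divides zero a≡) =
    ⊥-elim (ℤP.<-irrefl (cong +_ (sym (trans (+-identityʳ a) a≡))) pos)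
  sufficiency (+ a) (+ suc F₀) (_ , _ , ℕ.divides zero a≡) =
    recursion-from-admissible F≥1 P≡ (+ a) (cong +_ (cong₂ _+_ a≡ β≡)) (cong +_ β≡) admissible
    where
    open RegimeB F₀ 0 using (F≥1; P≡; admissible)
    β≡ : suc F₀ + (0 + 0) ≡ suc F₀
    β≡ = +-identityʳ (suc F₀)
  sufficiency -[1+ a ] (+ b) (_ , _ , ℕ.divides zero ())
  sufficiency -[1+ a ] (+ b) (_ , pos , ℕ.divides (suc q₀) a≡) = negative-regime (0<⊖ b (suc a) pos)
    where
    negative-regime : suc a < b → Σ MetaFib (IsConollyRecursion -[1+ a ] (+ b))
    negative-regime a<b with b ∸ suc a | m<n⇒0<n∸m a<b | m+[n∸m]≡n (<⇒≤ a<b)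
    ... | suc F₀ | _ | b≡ = recursion-from-admissible F≥1 P≡ -[1+ a ] F≡ β≡ admissible
      where
      open RegimeB F₀ (suc q₀) using (F≥1; P≡; admissible)
      β≡ : + (suc F₀ + (suc q₀ + suc q₀)) ≡ + b
      β≡ = cong +_ (trans (rearrange F₀ q₀) (trans (cong (λ z → z + suc F₀) (sym a≡)) b≡))
        where
        rearrange : ∀ F q → suc F + (suc q + suc q) ≡ suc q * 2 + suc F
        rearrange = solve-∀
      F≡ : -[1+ a ] ℤ.+ + (suc F₀ + (suc q₀ + suc q₀)) ≡ + suc F₀
      F≡ = begin
        -[1+ a ] ℤ.+ + (suc F₀ + (suc q₀ + suc q₀))   ≡⟨ cong (λ z → -[1+ a ] ℤ.+ z) β≡ ⟩
        b ℤ.⊖ suc a                                    ≡⟨ cong (ℤ._⊖ suc a) (sym b≡) ⟩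
        (suc a + suc F₀) ℤ.⊖ suc a                     ≡⟨ ℤP.⊖-≥ (m≤m+n (suc a) (suc F₀)) ⟩
        + (suc a + suc F₀ ∸ suc a)                     ≡⟨ cong +_ (m+n∸m≡n (suc a) (suc F₀)) ⟩
        + suc F₀ ∎
        where open ≡-Reasoning

  -- Necessity, first step: an (α,β)-Conolly sequence with α + β = F ≥ 1 and
  -- β ≥ 0 is the block sequence for F, β.  By induction on m we show that
  -- R n ≤ m holds exactly for n ≤ N m.
  module ConollyIsBlockSeq (F β : ℕ) (F≥1 : 1 ≤ F) {R : ℕ → ℕ} (nd : NondecPos R)
    (occ : ∀ m → 1 ≤ m → OccursExactly R m (+ Blocks.f F β m)) where
    open Blocks F β

    pos : ∀ n → 1 ≤ n → 1 ≤ R n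
    pos = proj₁ nd
    mon : ∀ m n → 1 ≤ m → m ≤ n → R m ≤ R n
    mon = proj₂ nd

    Level : ℕ → Set
    Level m = ∀ n → 1 ≤ n → (R n ≤ m → n ≤ N m) × (n ≤ N m → R n ≤ m)

    -- From level m to m+1: the f(m+1) occurrences of m+1 all lie after N m,
    -- and, R being nondecreasing, they must fill N m + 1, …, N(m+1).
    module NextLevel (m : ℕ) (ih : Level m) where
      o = occ (suc m) (s≤s z≤n)
      L = proj₁ o
      unique : Unique L
      unique = proj₁ (proj₂ o)
      length≡ : length L ≡ f (suc m)
      length≡ = ℤP.+-injective (proj₁ (proj₂ (proj₂ o)))
      ∈⇔ : ∀ k → 1 ≤ k → (R k ≡ suc m ⇔ k ∈ L)
      ∈⇔ = proj₁ (proj₂ (proj₂ (proj₂ o)))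
      L-pos : All.All (1 ≤_) L
      L-pos = proj₂ (proj₂ (proj₂ (proj₂ o)))
      fm = f (suc m)
      lo = suc (N m)
      member-value : ∀ {k} → k ∈ L → R k ≡ suc m
      member-value mem = Equivalence.from (∈⇔ _ (All.lookup L-pos mem)) mem
      member-after : ∀ {k} → k ∈ L → lo ≤ k
      member-after {k} mem with lo ≤? k
      ... | yes l = l
      ... | no nl = ⊥-elim (<-irrefl refl (≤-trans (≤-reflexive (sym (member-value mem)))
                                            (proj₂ (ih k (All.lookup L-pos mem)) (≤-pred (≰⇒> nl)))))
      nonempty : Σ ℕ λ x → x ∈ L
      nonempty with L | length≡
      ... | [] | e = ⊥-elim (<-irrefl e (≤-trans F≥1 (f≥F (suc m))))
      ... | x ∷ _ | _ = x , here refl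
      R-lo : R lo ≡ suc m
      R-lo = ≤-antisym (≤-trans (mon lo x (s≤s z≤n) (member-after x∈L)) (≤-reflexive (member-value x∈L))) down
        where
        x = proj₁ nonempty
        x∈L = proj₂ nonempty
        down : suc m ≤ R lo
        down with suc m ≤? R lo
        ... | yes l = l
        ... | no nl = ⊥-elim (<-irrefl refl (proj₁ (ih lo (s≤s z≤n)) (≤-pred (≰⇒> nl))))

      -- Otherwise lo, …, N(m+1) + 1 would be f(m+1) + 1 occurrences of m+1.
      upper : ∀ n → 1 ≤ n → R n ≤ suc m → n ≤ N (suc m)
      upper n 1≤n h with n ≤? N (suc m)
      ... | yes l = l
      ... | no nl = ⊥-elim (<-irrefl refl (begin-strict
            fm                           <⟨ n<1+n fm ⟩
            suc fm                       ≡⟨ sym (interval-length lo (suc fm)) ⟩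
            length (interval lo (suc fm)) ≤⟨ unique-length-≤ (interval lo (suc fm)) L (interval-unique lo (suc fm)) sub ⟩
            length L                     ≡⟨ length≡ ⟩
            fm ∎))
        where
        open ≤-Reasoning
        sub : ∀ {k} → k ∈ interval lo (suc fm) → k ∈ L
        sub {k} mem = Equivalence.to (∈⇔ k (≤-trans (s≤s z≤n) lo≤k)) Rk
          where
          lo≤k = proj₁ (∈-interval lo (suc fm) k mem)
          k≤n : k ≤ n
          k≤n = ≤-trans (≤-pred (proj₂ (∈-interval lo (suc fm) k mem))) (≤-trans (≤-reflexive (+-suc (N m) fm)) (≰⇒> nl))
          Rk : R k ≡ suc m
          Rk = ≤-antisym (≤-trans (mon k n (≤-trans (s≤s z≤n) lo≤k) k≤n) h)
                         (≤-trans (≤-reflexive (sym R-lo)) (mon lo k (s≤s z≤n) lo≤k))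

      -- Otherwise all f(m+1) occurrences of m+1 would lie in lo, …, n − 1.
      lower : ∀ n → 1 ≤ n → n ≤ N (suc m) → R n ≤ suc m
      lower n 1≤n h with n ≤? N m
      ... | yes l = ≤-trans (proj₂ (ih n 1≤n) l) (n≤1+n m)
      ... | no nl with R n ≤? suc m
      ...   | yes l = l
      ...   | no nl2 = ⊥-elim (<-irrefl refl (<-≤-trans window<fm (begin
            fm                           ≡⟨ sym length≡ ⟩
            length L                     ≤⟨ unique-length-≤ L (interval lo (n ∸ lo)) unique sub ⟩
            length (interval lo (n ∸ lo)) ≡⟨ interval-length lo (n ∸ lo) ⟩
            n ∸ lo ∎)))
        where
        open ≤-Reasoning
        lo≤n : lo ≤ n
        lo≤n = ≰⇒> nl
        window<fm : n ∸ lo < fm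
        window<fm = +-cancelˡ-< lo (n ∸ lo) fm (≤-trans (s≤s (≤-reflexive (m+[n∸m]≡n lo≤n))) (s≤s h))
        sub : ∀ {k} → k ∈ L → k ∈ interval lo (n ∸ lo)
        sub {k} mem = interval-∈ lo (n ∸ lo) k (member-after mem) (subst (k <_) (sym (m+[n∸m]≡n lo≤n)) k<n)
          where
          k<n : k < n
          k<n with k <? n
          ... | yes l = l
          ... | no nl3 = ⊥-elim (nl2 (≤-trans (mon n k 1≤n (≮⇒≥ nl3)) (≤-reflexive (member-value mem))))

    level : ∀ m → Level m
    level zero n 1≤n = (λ h → ⊥-elim (<-irrefl refl (≤-trans (pos n 1≤n) h))) , (λ h → ⊥-elim (<-irrefl refl (≤-trans 1≤n h)))
    level (suc m) n 1≤n = NextLevel.upper m (level m) n 1≤n , NextLevel.lower m (level m) n 1≤n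

    isBlockSeq : IsBlockSeq R
    isBlockSeq n 1≤n with R n in eq | pos n 1≤n
    ... | suc m | _ = m , refl , (after , proj₁ (level (suc m) n 1≤n) (≤-reflexive eq))
      where
      after : N m < n
      after with N m <? n
      ... | yes l = l
      ... | no nl = ⊥-elim (<-irrefl refl (≤-trans (≤-reflexive (sym eq)) (proj₂ (level m n 1≤n) (≮⇒≥ nl))))

  -- Counts are lengths, hence nonnegative: β < 0 would make the count of
  -- 2^a (or of 1) negative.
  no-negative-β : ∀ α b {R} → ¬ IsConolly α -[1+ b ] R
  no-negative-β (+ a) b (_ , occ) = <-irrefl refl (≤-trans (s≤s (m≤m+n a _)) (≤-trans (m≤m+n _ _) (≤-reflexive (sym a≡))))
    where
    o = occ (pow2 a) (pow2≥1 a)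
    count≡ : + a ℤ.+ -[1+ b ] ℤ.* (+ suc a) ≡ + length (proj₁ o)
    count≡ = sym (trans (proj₁ (proj₂ (proj₂ o))) (cong (λ z → + a ℤ.+ -[1+ b ] ℤ.* (+ suc z)) (v2-pow2 a)))
    a≡ : a ≡ suc (a + b * suc a) + length (proj₁ o)
    a≡ = ⊖≡+ a (suc (a + b * suc a)) _ count≡
  no-negative-β -[1+ a ] b (_ , occ) with occ 1 (s≤s z≤n)
  ... | _ , _ , () , _

  -- The value R 1 occurs, so α + β ≠ 0 unless −α = β > 0, which is excluded.
  sum-nonzero : ∀ α b {R} → ¬ ((ℤ.- α ≡ + b) × (+ 0 ℤ.< + b)) → IsConolly α (+ b) R → α ℤ.+ + b ≢ + 0
  sum-nonzero -[1+ a ] b excl _ e = excl (cong +_ (sym b≡) , +<+ (subst (0 <_) (sym b≡) (s≤s z≤n)))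
    where
    b≡ : b ≡ suc a
    b≡ = trans (⊖≡+ b (suc a) 0 e) (+-identityʳ (suc a))
  sum-nonzero (+ zero) zero {R} _ (nd , occ) _ with occ (R 1) (proj₁ nd 1 (s≤s z≤n))
  ... | xs , _ , len≡ , ∈⇔ , _ with xs | Equivalence.to (∈⇔ 1 (s≤s z≤n)) refl | len≡
  ...   | _ ∷ _ | _ | ()
  sum-nonzero (+ zero) (suc _) _ _ ()
  sum-nonzero (+ suc _) _ _ _ ()

  first-count : ∀ α b {R} → ¬ ((ℤ.- α ≡ + b) × (+ 0 ℤ.< + b)) → IsConolly α (+ b) R →
                Σ ℕ λ F → (α ℤ.+ + b ≡ + F) × 1 ≤ F
  first-count α b excl conolly with length (proj₁ (proj₂ conolly 1 (s≤s z≤n))) | count≡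
    where
    count≡ : α ℤ.+ + b ≡ + length (proj₁ (proj₂ conolly 1 (s≤s z≤n)))
    count≡ = sym (trans (proj₁ (proj₂ (proj₂ (proj₂ conolly 1 (s≤s z≤n))))) (cong (λ z → α ℤ.+ z) (ℤP.*-identityʳ (+ b))))
  ... | suc F₀ | e = suc F₀ , e , s≤s z≤n
  ... | zero | e = ⊥-elim (sum-nonzero α b excl conolly e)

  half-difference : ∀ x b p → x + (b + b) ≡ p + p → x ≡ (p ∸ b) * 2
  half-difference x b p e with b ≤? p
  ... | no nl = ⊥-elim (<-irrefl (sym e) (<-≤-trans (+-mono-< (≰⇒> nl) (≰⇒> nl)) (m≤n+m (b + b) x)))
  ... | yes le = +-cancelʳ-≡ (b + b) _ _ (trans e (trans (cong₂ _+_ (sym (m+[n∸m]≡n le)) (sym (m+[n∸m]≡n le))) (rearrange b (p ∸ b))))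
    where
    rearrange : ∀ b d → (b + d) + (b + d) ≡ d * 2 + (b + b)
    rearrange = solve-∀

  -- α + β = F and F + β = 2p make α = 2(p − β) even.
  even-from-order : ∀ α b F p → α ℤ.+ + b ≡ + F → F + b ≡ p + p → + 2 ∣ α
  even-from-order (+ a) b F p e P≡ =
    ℕ.divides (p ∸ b) (half-difference a b p (trans (sym (+-assoc a b b)) (trans (cong (λ z → z + b) (ℤP.+-injective e)) P≡)))
  even-from-order -[1+ a ] b F p e P≡ =
    ℕ.divides (p ∸ F) (half-difference (suc a) F p (trans (rearrange (suc a) F) (trans (cong (λ z → F + z) (sym (⊖≡+ b (suc a) F e))) P≡)))
    where
    rearrange : ∀ x F → x + (F + F) ≡ F + (x + F)
    rearrange = solve-∀

  necessity : (α β : ℤ) → ¬ ((ℤ.- α ≡ β) × (+ 0 ℤ.< β)) → Σ MetaFib (IsConollyRecursion α β) →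
              (+ 0 ℤ.≤ β) × (+ 0 ℤ.< α ℤ.+ β) × (+ 2 ∣ α)
  necessity α -[1+ b ] _ (_ , _ , _ , _ , conolly) = ⊥-elim (no-negative-β α b conolly)
  necessity α (+ b) excl (M , c , R , solves , conolly) with first-count α b excl conolly
  ... | F , F≡ , F≥1 = +≤+ z≤n , subst (+ 0 ℤ.<_) (sym F≡) (+<+ F≥1) , even-from-order α b F (MetaFib.p M) F≡ P≡
    where
    occurrences : ∀ m → 1 ≤ m → OccursExactly R m (+ Blocks.f F b m)
    occurrences m h = subst (OccursExactly R m) (conolly-count α b F F≡ m) (proj₂ conolly m h)
    P≡ : F + b ≡ MetaFib.p M + MetaFib.p M
    P≡ = Asymptotics.forced-order F b F≥1 (ConollyIsBlockSeq.isBlockSeq F b F≥1 (proj₁ conolly) occurrences) M c solves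

open import Defs
open import Data.Integer using (ℤ; +_; -_; _+_; _<_; _≤_)
open import Data.Integer.Divisibility using (_∣_)
open import Data.Product using (Σ; _×_)
open import Function.Bundles using (_⇔_; mk⇔)
open import Relation.Nullary using (¬_)
open import Relation.Binary.PropositionalEquality using (_≡_)

theorem4p1 : (α β : ℤ) → ¬ ((- α ≡ β) × (+ 0 < β)) →
    (Σ MetaFib (λ F → IsConollyRecursion α β F)) ⇔
    ((+ 0 ≤ β) × (+ 0 < α + β) × (+ 2 ∣ α))
theorem4p1 α β excluded =
  mk⇔ (ConollyCorrespondence.necessity α β excluded) (ConollyCorrespondence.sufficiency α β)
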